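{- Let $p$ be a prime and let $A=(a_1,\dots,a_\ell)$ be a sequence of $\ell\geqslant2$ nonzero elements of $\mathbb{F}_p$ such that $|\Sigma(A)|=\ell+2<p$. Then one of the following holds: (i) there exist $r\in\mathbb{F}_p^*$ and $i_0\in[1,\ell]$ such that $a_{i_0}\in\{2r,-2r\}$ and $a_i\in\{r,-r\}$ for all $i\neq i_0$; (ii) $\ell=2$.
   Context: $\Sigma(A)=\sum_{i=1}^\ell\{0,a_i\}=\{\sum_{i\in J}a_i : J\subseteq[1,\ell]\}$ is the set of subsums of $A$. -}

module Defs where

open import Data.Nat using (ℕ; zero; suc; _+_; _*_; _∸_; NonZero)
open import Data.Nat.DivMod using (_%_)
open import Data.Nat.Properties using (_≟_)
open import Data.Fin using (Fin)
import Data.Fin as Fin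
open import Data.List using (List; []; _∷_; _++_; map; filter; length; upTo)
open import Data.List.Relation.Unary.Any using (any?)

-- The prime field 𝔽_p is modelled by the natural numbers {0,…,p-1}
-- with arithmetic modulo p.

_+[_]_ : ℕ → (p : ℕ) → .{{NonZero p}} → ℕ → ℕ
x +[ p ] y = (x + y) % p

neg[_] : (p : ℕ) → .{{NonZero p}} → ℕ → ℕ
neg[ p ] x = (p ∸ (x % p)) % p

two*[_] : (p : ℕ) → .{{NonZero p}} → ℕ → ℕ
two*[ p ] r = (2 * r) % p

-- list of all subsums Σ_{i∈J} a_i (J ⊆ [1,ℓ]), computed in 𝔽_p
-- (with repetitions; the empty subsum 0 included)
subsums : (p : ℕ) → .{{NonZero p}} → (ℓ : ℕ) → (Fin ℓ → ℕ) → List ℕ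
subsums p zero    a = 0 % p ∷ []
subsums p (suc ℓ) a =
  let S = subsums p ℓ (λ i → a (Fin.suc i))
  in S ++ map (λ s → a Fin.zero +[ p ] s) S

cardΣ : (p : ℕ) → .{{NonZero p}} → (ℓ : ℕ) → (Fin ℓ → ℕ) → ℕ
cardΣ p ℓ a = length (filter (λ x → any? (x ≟_) (subsums p ℓ a)) (upTo p))

module Submission where

-- Everything rests on what prepending a nonzero term a₀ to a sequence b does to Σ:
--   growth:    |Σ(a₀ ∷ b)| > |Σ(b)| unless Σ(b) = 𝔽_p, hence |Σ(a)| ≥ ℓ + 1;
--   extension: if Σ(b) is a progression x, x + r, …, x + (m-1)·r and a₀ ≈ ±d·r with d ≤ m,
--              then Σ(a₀ ∷ b) is a progression of length d + m;
--   overlap:   if instead a₀ ≈ t·r with k ≤ t ≤ p - k and k ≤ m, then |Σ(a₀ ∷ b)| ≥ m + k.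
-- Consequently |Σ(a)| = ℓ + 1 forces all terms to be ±r (minimal-card). For ℓ ≥ 3 induct on
-- ℓ: the tail has ℓ or ℓ + 1 subsums, so it is ±r (and then a₀ ≈ ±2r) or, by induction, of
-- type (i) (and then a₀ ≈ ±r). For ℓ = 3 the tail may be an unrelated pair with four
-- subsums; then a counting argument, after reordering the three terms, settles the case.

open import Defs
open import Data.Nat using (ℕ; _<_; _≤_; _+_; NonZero)
open import Data.Nat.Primality using (Prime)
open import Data.Fin using (Fin)
open import Data.Product using (Σ; _×_)
open import Data.Sum using (_⊎_)
open import Relation.Binary.PropositionalEquality using (_≡_; _≢_)

open import Data.Bool using (Bool; true; false; if_then_else_)
open import Data.Nat using (zero; suc; z≤n; s≤s; s≤s⁻¹)
open import Data.Nat.Properties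
  using (_≟_; ≤-refl; ≤-reflexive; ≤-trans; <-≤-trans; <-irrefl; <⇒≢; ≤∧≢⇒<; m<n⇒m<1+n; m≤n⇒m≤1+n;
         m<1+n⇒m<n∨m≡n; n<1⇒n≡0; +-identityʳ; +-suc; +-comm)
open import Data.Product using (_,_; proj₂)
open import Data.Sum using (inj₁; inj₂; [_,_]′)
open import Data.Empty using (⊥-elim)
open import Data.List using (length; filter; upTo; _++_; [_])
open import Data.List.Properties using (upTo-∷ʳ; filter-++; length-++)
open import Relation.Nullary using (¬_; Dec; does; yes; no)
open import Relation.Unary using (Decidable)
open import Relation.Binary.PropositionalEquality hiding ([_])
open import Function using (_∘′_; case_of_)

count : (ℕ → Bool) → ℕ → ℕ
count f zero    = 0
count f (suc n) = if f n then suc (count f n) else count f n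

count-cong : ∀ {f g} n → (∀ y → y < n → f y ≡ g y) → count f n ≡ count g n
count-cong zero    f≡g = refl
count-cong {f} {g} (suc n) f≡g rewrite f≡g n ≤-refl
  | count-cong {f} {g} n (λ y y<n → f≡g y (m<n⇒m<1+n y<n)) = refl

count-mono : ∀ {f g} n → (∀ y → y < n → f y ≡ true → g y ≡ true) → count f n ≤ count g n
count-mono zero f⊆g = z≤n
count-mono {f} {g} (suc n) f⊆g with f n in fn | g n in gn
... | true  | true  = s≤s (count-mono n (λ y y<n → f⊆g y (m<n⇒m<1+n y<n)))
... | true  | false with () ← trans (sym (f⊆g n ≤-refl fn)) gn
... | false | true  = m≤n⇒m≤1+n (count-mono n (λ y y<n → f⊆g y (m<n⇒m<1+n y<n)))
... | false | false = count-mono n (λ y y<n → f⊆g y (m<n⇒m<1+n y<n))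

count-all : ∀ n → count (λ _ → true) n ≡ n
count-all zero    = refl
count-all (suc n) = cong suc (count-all n)

count-none : ∀ f n → (∀ y → y < n → f y ≡ false) → count f n ≡ 0
count-none f zero    f≡false = refl
count-none f (suc n) f≡false rewrite f≡false n ≤-refl =
  count-none f n (λ y y<n → f≡false y (m<n⇒m<1+n y<n))

remove : (ℕ → Bool) → ℕ → ℕ → Bool
remove f z y with y ≟ z
... | yes _ = false
... | no  _ = f y

remove-other : ∀ f {z y} → y ≢ z → remove f z y ≡ f y
remove-other f {z} {y} y≢z with y ≟ z
... | yes y≡z = ⊥-elim (y≢z y≡z)
... | no  _   = refl

remove-true : ∀ f z y → remove f z y ≡ true → f y ≡ true × y ≢ z
remove-true f z y h with y ≟ z
... | no y≢z = h , y≢z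

count-remove-outside : ∀ f z n → n ≤ z → count (remove f z) n ≡ count f n
count-remove-outside f z n n≤z = count-cong n (λ y y<n → remove-other f (<⇒≢ (<-≤-trans y<n n≤z)))

count-remove : ∀ f z n → z < n → f z ≡ true → count f n ≡ suc (count (remove f z) n)
count-remove f z (suc n) z<1+n fz with n ≟ z
... | yes refl rewrite fz = cong suc (sym (count-remove-outside f n n ≤-refl))
... | no n≢z with f n
...   | true  = cong suc (count-remove f z n (≤∧≢⇒< (s≤s⁻¹ z<1+n) (n≢z ∘′ sym)) fz)
...   | false = count-remove f z n (≤∧≢⇒< (s≤s⁻¹ z<1+n) (n≢z ∘′ sym)) fz

count-remove-≤ : ∀ f z n → count f n ≤ suc (count (remove f z) n)
count-remove-≤ f z zero = z≤n
count-remove-≤ f z (suc n) with n ≟ z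
... | yes refl with f n
...   | true  = s≤s (≤-reflexive (sym (count-remove-outside f n n ≤-refl)))
...   | false = m≤n⇒m≤1+n (≤-reflexive (sym (count-remove-outside f n n ≤-refl)))
count-remove-≤ f z (suc n) | no n≢z with f n
...   | true  = s≤s (count-remove-≤ f z n)
...   | false = count-remove-≤ f z n

count-extra : ∀ {f g} n (h : ℕ → ℕ) k → (∀ y → y < n → g y ≡ true → f y ≡ true)
  → (∀ j → j < k → h j < n) → (∀ j → j < k → f (h j) ≡ true) → (∀ j → j < k → g (h j) ≡ false)
  → (∀ i j → i < k → j < k → h i ≡ h j → i ≡ j) → count g n + k ≤ count f n
count-extra {f} {g} n h zero g⊆f _ _ _ _ = ≤-trans (≤-reflexive (+-identityʳ _)) (count-mono n g⊆f)
count-extra {f} {g} n h (suc k) g⊆f below inF outG inj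
  rewrite count-remove f (h k) n (below k ≤-refl) (inF k ≤-refl) | +-suc (count g n) k =
  s≤s (count-extra n h k g⊆f′ (λ j j<k → below j (m<n⇒m<1+n j<k)) inF′ (λ j j<k → outG j (m<n⇒m<1+n j<k))
        (λ i j i<k j<k → inj i j (m<n⇒m<1+n i<k) (m<n⇒m<1+n j<k)))
  where
  g⊆f′ : ∀ y → y < n → g y ≡ true → remove f (h k) y ≡ true
  g⊆f′ y y<n gy = trans (remove-other f (λ { refl → case trans (sym (outG k ≤-refl)) gy of λ () })) (g⊆f y y<n gy)
  inF′ : ∀ j → j < k → remove f (h k) (h j) ≡ true
  inF′ j j<k = trans (remove-other f (<⇒≢ j<k ∘′ inj j k (m<n⇒m<1+n j<k) ≤-refl)) (inF j (m<n⇒m<1+n j<k))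

count-injection : ∀ f n (h : ℕ → ℕ) k → (∀ i → i < k → h i < n) → (∀ i → i < k → f (h i) ≡ true)
  → (∀ i j → i < k → j < k → h i ≡ h j → i ≡ j) → k ≤ count f n
count-injection f n h k below inF inj =
  subst (λ c → c + k ≤ count f n) (count-none (λ _ → false) n (λ _ _ → refl))
    (count-extra n h k (λ _ _ ()) below inF (λ _ _ → refl) inj)

count-grow : ∀ {f g} z n → (∀ y → y < n → g y ≡ true → f y ≡ true) → z < n → f z ≡ true → g z ≡ false
  → suc (count g n) ≤ count f n
count-grow {f} {g} z n g⊆f z<n fz gz = subst (_≤ count f n) (+-comm (count g n) 1)
  (count-extra n (λ _ → z) 1 g⊆f (λ _ _ → z<n) (λ _ _ → fz) (λ _ _ → gz)
    (λ i j i<1 j<1 _ → trans (n<1⇒n≡0 i<1) (sym (n<1⇒n≡0 j<1))))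

count-grow₂ : ∀ {f g} u v n → (∀ y → y < n → g y ≡ true → f y ≡ true) → u ≢ v → u < n → v < n
  → f u ≡ true → f v ≡ true → g u ≡ false → g v ≡ false → count g n + 2 ≤ count f n
count-grow₂ u v n g⊆f u≢v u<n v<n fu fv gu gv = count-extra n h 2 g⊆f
  (λ { 0 _ → u<n ; (suc _) _ → v<n }) (λ { 0 _ → fu ; (suc _) _ → fv }) (λ { 0 _ → gu ; (suc _) _ → gv })
  (λ { 0 0 _ _ _ → refl ; 0 (suc _) _ _ u≡v → ⊥-elim (u≢v u≡v) ; (suc _) 0 _ _ v≡u → ⊥-elim (u≢v (sym v≡u))
     ; (suc i) (suc j) i<2 j<2 _ → cong suc (trans (n<1⇒n≡0 (s≤s⁻¹ i<2)) (sym (n<1⇒n≡0 (s≤s⁻¹ j<2)))) })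
  where
  h : ℕ → ℕ
  h 0 = u
  h _ = v

count-cover : ∀ f n (g : ℕ → ℕ) k → (∀ y → y < n → f y ≡ true → Σ ℕ λ i → i < k × y ≡ g i) → count f n ≤ k
count-cover f n g zero    covered = ≤-reflexive (count-none f n empty)
  where
  empty : ∀ y → y < n → f y ≡ false
  empty y y<n with f y in fy
  ... | true  with () ← covered y y<n fy
  ... | false = refl
count-cover f n g (suc k) covered =
  ≤-trans (count-remove-≤ f (g k) n) (s≤s (count-cover (remove f (g k)) n g k covered′))
  where
  covered′ : ∀ y → y < n → remove f (g k) y ≡ true → Σ ℕ λ i → i < k × y ≡ g i
  covered′ y y<n fy with remove-true f (g k) y fy
  ... | fy , y≢gk with covered y y<n fy
  ...   | i , i<1+k , refl = i , ≤∧≢⇒< (s≤s⁻¹ i<1+k) (y≢gk ∘′ cong g) , refl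

exists-missing : ∀ f n → count f n < n → Σ ℕ λ w → w < n × f w ≡ false
exists-missing f (suc n) small with f n in fn
... | false = n , ≤-refl , fn
... | true  with w , w<n , fw ← exists-missing f n (s≤s⁻¹ small) = w , m<n⇒m<1+n w<n , fw

boundary : (f : ℕ → Bool) (o : ℕ) → f 0 ≡ true → f o ≡ false → Σ ℕ λ j → f j ≡ true × f (suc j) ≡ false
boundary f zero    f0 fo with () ← trans (sym f0) fo
boundary f (suc o) f0 fo with f o in fo′
... | true  = o , fo′ , fo
... | false = boundary f o f0 fo′

search : {P : ℕ → Set} → Decidable P → ∀ n → (Σ ℕ λ o → o < n × P o) ⊎ (∀ o → o < n → ¬ P o)
search P? zero = inj₂ (λ o ())
search P? (suc n) with P? n | search P? n
... | yes Pn | _                   = inj₁ (n , ≤-refl , Pn)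
... | no ¬Pn | inj₁ (o , o<n , Po) = inj₁ (o , m<n⇒m<1+n o<n , Po)
... | no ¬Pn | inj₂ none           = inj₂ λ o o<1+n → [ none o , (λ { refl → ¬Pn }) ]′ (m<1+n⇒m<n∨m≡n o<1+n)

injection-onto : ∀ n (g : ℕ → ℕ) → (∀ i → i < n → g i < n) → (∀ i j → i < n → j < n → g i ≡ g j → i ≡ j)
  → ∀ y → y < n → Σ ℕ λ o → o < n × g o ≡ y
injection-onto n g below inj y y<n with search (λ o → g o ≟ y) n
... | inj₁ hit  = hit
... | inj₂ miss = ⊥-elim (<-irrefl refl (<-≤-trans fewer many))
  where
  all-but-y = remove (λ _ → true) y
  many : n ≤ count all-but-y n
  many = count-injection all-but-y n g n below (λ i i<n → remove-other (λ _ → true) (miss i i<n)) inj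
  fewer : count all-but-y n < n
  fewer = subst (count all-but-y n <_) (count-all n) (≤-reflexive (sym (count-remove _ y n y<n refl)))

does-true⁻ : ∀ {A : Set} (a? : Dec A) → does a? ≡ true → A
does-true⁻ (yes a) _ = a

length-filter-upTo : ∀ {P : ℕ → Set} (P? : Decidable P) n → length (filter P? (upTo n)) ≡ count (λ x → does (P? x)) n
length-filter-upTo P? zero = refl
length-filter-upTo P? (suc n) = begin
  length (filter P? (upTo (suc n)))                       ≡⟨ cong (length ∘′ filter P?) (upTo-∷ʳ n) ⟨
  length (filter P? (upTo n ++ [ n ]))                    ≡⟨ cong length (filter-++ P? (upTo n) [ n ]) ⟩
  length (filter P? (upTo n) ++ filter P? [ n ])          ≡⟨ length-++ (filter P? (upTo n)) ⟩
  length (filter P? (upTo n)) + length (filter P? [ n ])  ≡⟨ cong (_+ length (filter P? [ n ])) (length-filter-upTo P? n) ⟩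
  count (λ x → does (P? x)) n + length (filter P? [ n ])  ≡⟨ last-step ⟩
  count (λ x → does (P? x)) (suc n)                       ∎
  where
  open ≡-Reasoning
  last-step : count (λ x → does (P? x)) n + length (filter P? [ n ]) ≡ count (λ x → does (P? x)) (suc n)
  last-step with does (P? n)
  ... | true  = +-comm _ 1
  ... | false = +-identityʳ _

module Modulo (p : ℕ) .{{_ : NonZero p}} (prime : Prime p) where

  open import Data.Nat as ℕ using (_∸_)
  import Data.Nat.Properties as ℕ
  open import Data.Nat.DivMod using (_%_; m%n<n; m<n⇒m%n≡m)
  open import Data.Nat.Divisibility using (n∣m⇒m%n≡0) renaming (_∣_ to _ℕ∣_)
  open import Data.Nat.Primality using (euclidsLemma)
  -- Integer addition is written +ℤ: + is the addition of ℕ used in the statement.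
  open import Data.Integer using (ℤ; +_; -_; _-_; _*_; 0ℤ; ∣_∣; _%ℕ_; _/ℕ_) renaming (_+_ to _+ℤ_)
  import Data.Integer.Properties as ℤ
  open import Data.Integer.DivMod using (n%ℕd<d; a≡a%ℕn+[a/ℕn]*n)
  open import Data.Integer.Divisibility.Signed
    using (_∣_; divides; ∣-refl; ∣m∣n⇒∣m+n; ∣m⇒∣-m; ∣n⇒∣m*n; ∣⇒∣ᵤ; ∣ᵤ⇒∣)
  open import Data.Integer.Tactic.RingSolver using (solve-∀)
  open import Data.Fin using (zero; suc)
  open import Data.Fin.Properties using (suc-injective)
  open import Data.Vec.Functional using (Vector; head; tail; _∷_)
  open import Data.List.Membership.Propositional using (_∈_)
  open import Data.List.Membership.Propositional.Properties using (∈-map⁺; ∈-map⁻; ∈-++⁺ˡ; ∈-++⁺ʳ; ∈-++⁻)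
  open import Data.List.Relation.Unary.Any using (here; there; any?)
  open import Data.Product using (proj₁)
  open import Data.Sum using (map)
  open import Relation.Nullary.Decidable using (dec-true; dec-false; _⊎-dec_)
  open import Relation.Binary using (Setoid)
  import Relation.Binary.Reasoning.Setoid

  private variable
    ℓ : ℕ

  -- Residues are integers up to x ≈ y, meaning p ∣ x - y. The relation is a record so
  -- that x and y can be recovered from a proof.
  infix 4 _≈_ _≉_
  record _≈_ (x y : ℤ) : Set where
    constructor by-divisibility
    field divisibility : + p ∣ x - y

  _≉_ : ℤ → ℤ → Set
  x ≉ y = ¬ (x ≈ y)

  private
    diff-sym : ∀ x y → - (x - y) ≡ y - x
    diff-sym = solve-∀
    diff-trans : ∀ x y z → (x - y) +ℤ (y - z) ≡ x - z
    diff-trans = solve-∀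
    diff-+ : ∀ x y u v → (x - y) +ℤ (u - v) ≡ (x +ℤ u) - (y +ℤ v)
    diff-+ = solve-∀
    diff-neg : ∀ x y → y - x ≡ (- x) - (- y)
    diff-neg = solve-∀
    diff-* : ∀ x y u v → (x - y) * u +ℤ y * (u - v) ≡ x * u - y * v
    diff-* = solve-∀
    diff-cancel : ∀ z x y → (z +ℤ x) - (z +ℤ y) ≡ x - y
    diff-cancel = solve-∀
    diff-factor : ∀ x y r → x * r - y * r ≡ (x - y) * r - 0ℤ
    diff-factor = solve-∀
    diff-0 : ∀ x → x - 0ℤ ≡ x
    diff-0 = solve-∀

  ≈-via : ∀ {x y u v} → x ≈ y → x - y ≡ u - v → u ≈ v
  ≈-via (by-divisibility d) eq = by-divisibility (subst (+ p ∣_) eq d)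

  ≈-via₂ : ∀ {x y x′ y′ u v} → x ≈ y → x′ ≈ y′ → (x - y) +ℤ (x′ - y′) ≡ u - v → u ≈ v
  ≈-via₂ (by-divisibility d) (by-divisibility d′) eq = by-divisibility (subst (+ p ∣_) eq (∣m∣n⇒∣m+n d d′))

  ∣⇒≈0 : ∀ {z} → + p ∣ z → z ≈ 0ℤ
  ∣⇒≈0 {z} d = by-divisibility (subst (+ p ∣_) (sym (diff-0 z)) d)

  multiple≈0 : ∀ k → k * + p ≈ 0ℤ
  multiple≈0 k = ∣⇒≈0 (∣n⇒∣m*n k ∣-refl)

  p≈0 : + p ≈ 0ℤ
  p≈0 = ∣⇒≈0 ∣-refl

  ≈-refl : ∀ {x} → x ≈ x
  ≈-refl {x} = by-divisibility (subst (+ p ∣_) (sym (ℤ.+-inverseʳ x)) (divides 0ℤ refl))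

  ≈-reflexive : ∀ {x y} → x ≡ y → x ≈ y
  ≈-reflexive refl = ≈-refl

  ≈-sym : ∀ {x y} → x ≈ y → y ≈ x
  ≈-sym {x} {y} (by-divisibility d) = by-divisibility (subst (+ p ∣_) (diff-sym x y) (∣m⇒∣-m d))

  ≈-trans : ∀ {x y z} → x ≈ y → y ≈ z → x ≈ z
  ≈-trans {x} {y} {z} x≈y y≈z = ≈-via₂ x≈y y≈z (diff-trans x y z)

  ≈-setoid : Setoid _ _
  ≈-setoid = record { _≈_ = _≈_ ; isEquivalence = record { refl = ≈-refl ; sym = ≈-sym ; trans = ≈-trans } }

  module ≈-Reasoning = Relation.Binary.Reasoning.Setoid ≈-setoid

  +-cong : ∀ {x y u v} → x ≈ y → u ≈ v → x +ℤ u ≈ y +ℤ v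
  +-cong {x} {y} {u} {v} x≈y u≈v = ≈-via₂ x≈y u≈v (diff-+ x y u v)

  +-congˡ : ∀ x {y z} → y ≈ z → x +ℤ y ≈ x +ℤ z
  +-congˡ x = +-cong (≈-refl {x})

  +-congʳ : ∀ z {x y} → x ≈ y → x +ℤ z ≈ y +ℤ z
  +-congʳ z x≈y = +-cong x≈y (≈-refl {z})

  neg-cong : ∀ {x y} → x ≈ y → - x ≈ - y
  neg-cong {x} {y} x≈y = ≈-via (≈-sym x≈y) (diff-neg x y)

  *-cong : ∀ {x y u v} → x ≈ y → u ≈ v → x * u ≈ y * v
  *-cong {x} {y} {u} {v} (by-divisibility d) (by-divisibility e) = by-divisibility
    (subst (+ p ∣_) (diff-* x y u v) (∣m∣n⇒∣m+n (subst (+ p ∣_) (ℤ.*-comm u (x - y)) (∣n⇒∣m*n u d)) (∣n⇒∣m*n y e)))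

  +-cancelˡ : ∀ {z x y} → z +ℤ x ≈ z +ℤ y → x ≈ y
  +-cancelˡ {z} {x} {y} e = ≈-via e (diff-cancel z x y)

  zero-product : ∀ x y → x * y ≈ 0ℤ → x ≈ 0ℤ ⊎ y ≈ 0ℤ
  zero-product x y (by-divisibility d) = map (∣⇒≈0 ∘′ ∣ᵤ⇒∣) (∣⇒≈0 ∘′ ∣ᵤ⇒∣)
    (euclidsLemma ∣ x ∣ ∣ y ∣ prime (subst (p ℕ∣_) (ℤ.abs-* x y) (∣⇒∣ᵤ (subst (+ p ∣_) (diff-0 (x * y)) d))))

  *-cancelʳ : ∀ {r x y} → r ≉ 0ℤ → x * r ≈ y * r → x ≈ y
  *-cancelʳ {r} {x} {y} r≉0 xr≈yr =
    [ (λ x-y≈0 → ≈-via x-y≈0 (diff-0 (x - y))) , (λ r≈0 → ⊥-elim (r≉0 r≈0)) ]′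
      (zero-product (x - y) r (≈-via xr≈yr (diff-factor x y r)))

  private
    diff-residue : ∀ r q n → (- q) * n ≡ r - (r +ℤ q * n)
    diff-residue = solve-∀

  residue : ℤ → ℕ
  residue x = x %ℕ p

  residue-< : ∀ x → residue x < p
  residue-< x = n%ℕd<d x p

  residue-≈ : ∀ x → + residue x ≈ x
  residue-≈ x = ≈-via (multiple≈0 (- (x /ℕ p))) (begin
    - (x /ℕ p) * + p - 0ℤ                           ≡⟨ diff-0 _ ⟩
    - (x /ℕ p) * + p                                ≡⟨ diff-residue (+ residue x) (x /ℕ p) (+ p) ⟩
    + residue x - (+ residue x +ℤ (x /ℕ p) * + p)   ≡⟨ cong (_-_ (+ residue x)) (a≡a%ℕn+[a/ℕn]*n x p) ⟨
    + residue x - x                                 ∎)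
    where open ≡-Reasoning

  -- Distinct numbers below p are incongruent: their difference is smaller than p.
  ≤-≈⇒≡ : ∀ {x y} → x ≤ y → y < p → + y ≈ + x → y ≡ x
  ≤-≈⇒≡ {x} {y} x≤y y<p (by-divisibility d) = ℕ.≤-antisym (ℕ.m∸n≡0⇒m≤n y∸x≡0) x≤y
    where
    p∣y∸x : p ℕ∣ y ∸ x
    p∣y∸x = ∣⇒∣ᵤ (subst (+ p ∣_) (trans (ℤ.m-n≡m⊖n y x) (ℤ.⊖-≥ x≤y)) d)
    y∸x≡0 : y ∸ x ≡ 0
    y∸x≡0 = trans (sym (m<n⇒m%n≡m (ℕ.≤-<-trans (ℕ.m∸n≤m y x) y<p))) (n∣m⇒m%n≡0 _ p p∣y∸x)

  ≈⇒≡ : ∀ {x y} → x < p → y < p → + x ≈ + y → x ≡ y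
  ≈⇒≡ {x} {y} x<p y<p x≈y with ℕ.≤-total x y
  ... | inj₁ x≤y = sym (≤-≈⇒≡ x≤y y<p (≈-sym x≈y))
  ... | inj₂ y≤x = ≤-≈⇒≡ y≤x x<p x≈y

  residue-unique : ∀ {x y} → y < p → + y ≈ x → residue x ≡ y
  residue-unique {x} y<p y≈x = ≈⇒≡ (residue-< x) y<p (≈-trans (residue-≈ x) (≈-sym y≈x))

  residue-cong : ∀ {x y} → x ≈ y → residue x ≡ residue y
  residue-cong {x} {y} x≈y = residue-unique (residue-< y) (≈-trans (residue-≈ y) (≈-sym x≈y))

  infix 4 _≈?_
  _≈?_ : ∀ x y → Dec (x ≈ y)
  x ≈? y with residue x ℕ.≟ residue y
  ... | yes same  = yes (≈-trans (≈-sym (residue-≈ x)) (≈-trans (≈-reflexive (cong +_ same)) (residue-≈ y)))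
  ... | no differ = no (differ ∘′ residue-cong)

  0<p : 0 < p
  0<p = ℕ.>-nonZero⁻¹ p

  nonzero : ∀ {y} → y < p → y ≢ 0 → + y ≉ 0ℤ
  nonzero y<p y≢0 y≈0 = y≢0 (≈⇒≡ y<p 0<p y≈0)

  plus≈ : ∀ x y → + (x +[ p ] y) ≈ + x +ℤ + y
  plus≈ x y = ≈-trans (residue-≈ (+ (x ℕ.+ y))) (≈-reflexive (ℤ.pos-+ x y))

  neg≈ : ∀ x → + (neg[ p ] x) ≈ - + x
  neg≈ x = begin
    + ((p ∸ x % p) % p)   ≈⟨ residue-≈ (+ (p ∸ x % p)) ⟩
    + (p ∸ x % p)         ≡⟨ trans (ℤ.m-n≡m⊖n p (x % p)) (ℤ.⊖-≥ (ℕ.<⇒≤ (m%n<n x p))) ⟨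
    + p - + (x % p)       ≈⟨ +-cong p≈0 (neg-cong (residue-≈ (+ x))) ⟩
    0ℤ - + x              ≡⟨ ℤ.+-identityˡ (- + x) ⟩
    - + x                 ∎
    where open ≈-Reasoning

  two≈ : ∀ x → + (two*[ p ] x) ≈ + 2 * + x
  two≈ x = ≈-trans (residue-≈ (+ (2 ℕ.* x))) (≈-reflexive (ℤ.pos-* 2 x))

  private
    diff-steps : ∀ x i j r → (x +ℤ i * r) - (x +ℤ j * r) ≡ (i - j) * r - 0ℤ
    diff-steps = solve-∀

  progression-injective : ∀ {x r i j} → r ≉ 0ℤ → i < p → j < p → x +ℤ + i * r ≈ x +ℤ + j * r → i ≡ j
  progression-injective {x} {r} {i} {j} r≉0 i<p j<p e =
    ≈⇒≡ i<p j<p (*-cancelʳ r≉0 (≈-via e (trans (diff-steps x (+ i) (+ j) r) (sym (diff-factor (+ i) (+ j) r)))))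

  progression-onto : ∀ {r} → r ≉ 0ℤ → ∀ x {y} → y < p → Σ ℕ λ o → o < p × + y ≈ x +ℤ + o * r
  progression-onto {r} r≉0 x {y} y<p =
    let o , o<p , hit = injection-onto p point (λ i _ → residue-< (x +ℤ + i * r)) point-injective y y<p
    in o , o<p , ≈-trans (≈-reflexive (cong +_ (sym hit))) (residue-≈ (x +ℤ + o * r))
    where
    point : ℕ → ℕ
    point o = residue (x +ℤ + o * r)
    point-injective : ∀ i j → i < p → j < p → point i ≡ point j → i ≡ j
    point-injective i j i<p j<p same = progression-injective {x} r≉0 i<p j<p
      (≈-trans (≈-sym (residue-≈ (x +ℤ + i * r))) (≈-trans (≈-reflexive (cong +_ same)) (residue-≈ (x +ℤ + j * r))))

  multiple-onto : ∀ {r} → r ≉ 0ℤ → ∀ {y} → y < p → Σ ℕ λ o → o < p × + y ≈ + o * r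
  multiple-onto {r} r≉0 y<p =
    let o , o<p , y≈ = progression-onto r≉0 0ℤ y<p in o , o<p , ≈-trans y≈ (≈-reflexive (ℤ.+-identityˡ (+ o * r)))

  infix 4 _≈±_ _≈±?_
  _≈±_ : ℤ → ℤ → Set
  x ≈± y = x ≈ y ⊎ x ≈ - y

  _≈±?_ : ∀ x y → Dec (x ≈± y)
  x ≈±? y = (x ≈? y) ⊎-dec (x ≈? - y)

  ≈±-cong : ∀ {x y z} → y ≈ z → x ≈± y → x ≈± z
  ≈±-cong y≈z (inj₁ x≈y)  = inj₁ (≈-trans x≈y y≈z)
  ≈±-cong y≈z (inj₂ x≈-y) = inj₂ (≈-trans x≈-y (neg-cong y≈z))

  ≈±-neg : ∀ {x y} → x ≈± - y → x ≈± y
  ≈±-neg         (inj₁ x≈-y)  = inj₂ x≈-y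
  ≈±-neg {y = y} (inj₂ x≈--y) = inj₁ (≈-trans x≈--y (≈-reflexive (ℤ.neg-involutive y)))

  ≈±-trans : ∀ {x y z} → x ≈± y → y ≈± z → x ≈± z
  ≈±-trans x≈±y (inj₁ y≈z)  = ≈±-cong y≈z x≈±y
  ≈±-trans x≈±y (inj₂ y≈-z) = ≈±-neg (≈±-cong y≈-z x≈±y)

  ≈±-sym : ∀ {x y} → x ≈± y → y ≈± x
  ≈±-sym         (inj₁ x≈y)  = inj₁ (≈-sym x≈y)
  ≈±-sym {y = y} (inj₂ x≈-y) = ≈±-neg (inj₁ (≈-trans (≈-reflexive (sym (ℤ.neg-involutive y))) (neg-cong (≈-sym x≈-y))))

  one* : ∀ r → r ≈ + 1 * r
  one* r = ≈-reflexive (sym (ℤ.*-identityˡ r))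

  private
    diff-complement : ∀ t j r → t * r - - (j * r) ≡ (t +ℤ j) * r - 0ℤ
    diff-complement = solve-∀

  complement≈ : ∀ {t j} r → t ℕ.+ j ≡ p → + t * r ≈ - (+ j * r)
  complement≈ {t} {j} r t+j≡p = ≈-via sum≈0 (sym (diff-complement (+ t) (+ j) r))
    where
    open ≈-Reasoning
    sum≈0 : (+ t +ℤ + j) * r ≈ 0ℤ
    sum≈0 = begin
      (+ t +ℤ + j) * r  ≡⟨ cong (_* r) (trans (sym (ℤ.pos-+ t j)) (cong +_ t+j≡p)) ⟩
      + p * r           ≈⟨ *-cong p≈0 (≈-refl {r}) ⟩
      0ℤ * r            ≡⟨ ℤ.*-zeroˡ r ⟩
      0ℤ                ∎

  infix 4 _∈Σ_

  _∈Σ_ : ℕ → Vector ℕ ℓ → Set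
  y ∈Σ a = y ∈ subsums p _ a

  ∈Σ? : Vector ℕ ℓ → ℕ → Bool
  ∈Σ? a y = does (any? (y ≟_) (subsums p _ a))

  card : Vector ℕ ℓ → ℕ
  card a = count (∈Σ? a) p

  cardΣ≡card : ∀ ℓ (a : Vector ℕ ℓ) → cardΣ p ℓ a ≡ card a
  cardΣ≡card ℓ a = length-filter-upTo (λ y → any? (y ≟_) (subsums p ℓ a)) p

  ∈Σ?-complete : ∀ {a : Vector ℕ ℓ} {y} → y ∈Σ a → ∈Σ? a y ≡ true
  ∈Σ?-complete {a = a} {y} = dec-true (any? (y ≟_) (subsums p _ a))

  ∈Σ?-sound : ∀ {a : Vector ℕ ℓ} {y} → ∈Σ? a y ≡ true → y ∈Σ a
  ∈Σ?-sound {a = a} {y} = does-true⁻ (any? (y ≟_) (subsums p _ a))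

  ∈Σ?-false : ∀ {a : Vector ℕ ℓ} {y} → ¬ y ∈Σ a → ∈Σ? a y ≡ false
  ∈Σ?-false {a = a} {y} = dec-false (any? (y ≟_) (subsums p _ a))

  ∈Σ-tail : ∀ {a : Vector ℕ (suc ℓ)} {y} → y ∈Σ tail a → y ∈Σ a
  ∈Σ-tail = ∈-++⁺ˡ

  ∈Σ-shift : ∀ {a : Vector ℕ (suc ℓ)} {s} → s ∈Σ tail a → head a +[ p ] s ∈Σ a
  ∈Σ-shift {a = a} s∈ = ∈-++⁺ʳ (subsums p _ (tail a)) (∈-map⁺ (head a +[ p ]_) s∈)

  ∈Σ-shift≈ : ∀ {a : Vector ℕ (suc ℓ)} {s y} → y < p → s ∈Σ tail a → + y ≈ + head a +ℤ + s → y ∈Σ a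
  ∈Σ-shift≈ {a = a} {s} y<p s∈ y≈ =
    subst (_∈Σ a) (≈⇒≡ (m%n<n _ p) y<p (≈-trans (plus≈ (head a) s) (≈-sym y≈))) (∈Σ-shift {a = a} s∈)

  ∈Σ-cons⁻ : ∀ {a : Vector ℕ (suc ℓ)} {y} → y ∈Σ a
    → y ∈Σ tail a ⊎ Σ ℕ λ s → s ∈Σ tail a × y ≡ head a +[ p ] s
  ∈Σ-cons⁻ {a = a} y∈ with ∈-++⁻ (subsums p _ (tail a)) y∈
  ... | inj₁ y∈tail    = inj₁ y∈tail
  ... | inj₂ y∈shifted = inj₂ (∈-map⁻ (head a +[ p ]_) y∈shifted)

  0∈Σ : ∀ (a : Vector ℕ ℓ) → 0 ∈Σ a
  0∈Σ {zero}  a = here (sym (m<n⇒m%n≡m 0<p))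
  0∈Σ {suc ℓ} a = ∈Σ-tail {a = a} (0∈Σ (tail a))

  term∈Σ : ∀ (a : Vector ℕ ℓ) i → a i < p → a i ∈Σ a
  term∈Σ a zero    a₀<p = ∈Σ-shift≈ {a = a} a₀<p (0∈Σ (tail a)) (≈-reflexive (sym (ℤ.+-identityʳ (+ a zero))))
  term∈Σ a (suc i) aᵢ<p = ∈Σ-tail {a = a} (term∈Σ (tail a) i aᵢ<p)

  ∈Σ-< : ∀ (a : Vector ℕ ℓ) {y} → y ∈Σ a → y < p
  ∈Σ-< {zero}  a (here refl) = m%n<n 0 p
  ∈Σ-< {suc ℓ} a y∈ with ∈Σ-cons⁻ {a = a} y∈
  ... | inj₁ y∈tail         = ∈Σ-< (tail a) y∈tail
  ... | inj₂ (s , _ , refl) = m%n<n _ p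

  ∈Σ?-tail : ∀ (a : Vector ℕ (suc ℓ)) y → y < p → ∈Σ? (tail a) y ≡ true → ∈Σ? a y ≡ true
  ∈Σ?-tail a y _ = ∈Σ?-complete {a = a} ∘′ ∈Σ-tail {a = a} ∘′ ∈Σ?-sound {a = tail a} {y}

  card-⊆ : ∀ {ℓ ℓ′} (a : Vector ℕ ℓ) (b : Vector ℕ ℓ′) → (∀ {y} → y ∈Σ a → y ∈Σ b) → card a ≤ card b
  card-⊆ a b a⊆b = count-mono p (λ y _ → ∈Σ?-complete {a = b} ∘′ a⊆b ∘′ ∈Σ?-sound {a = a})

  card-tail : ∀ (a : Vector ℕ (suc ℓ)) → card (tail a) ≤ card a
  card-tail a = count-mono p (∈Σ?-tail a)

  private
    suc-* : ∀ j c → (+ 1 +ℤ j) * c ≡ c +ℤ j * c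
    suc-* = solve-∀

  suc-step : ∀ i c → + suc i * c ≡ c +ℤ + i * c
  suc-step i c = trans (cong (_* c) (ℤ.pos-+ 1 i)) (suc-* (+ i) c)

  -- Walking along 0, a₀, 2a₀, … from 0 ∈ Σ(b) to a residue outside Σ(b), the first step
  -- that leaves Σ(b) lands on a₀ plus a subsum of b.
  card-grow : ∀ (a : Vector ℕ (suc ℓ)) → head a < p → head a ≢ 0 → card (tail a) < p → suc (card (tail a)) ≤ card a
  card-grow a a₀<p a₀≢0 not-full =
    let w , w<p , w∉ = exists-missing (∈Σ? (tail a)) p not-full
        o , _ , w≈oa₀ = multiple-onto (nonzero a₀<p a₀≢0) w<p
        j , j∈ , sj∉ = boundary (∈Σ? (tail a) ∘′ multiple) o
                         (subst (λ y → ∈Σ? (tail a) y ≡ true) (sym multiple-0) (∈Σ?-complete {a = tail a} (0∈Σ (tail a))))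
                         (subst (λ y → ∈Σ? (tail a) y ≡ false) (sym (residue-unique w<p w≈oa₀)) w∉)
    in count-grow (multiple (suc j)) p (∈Σ?-tail a)
         (residue-< (+ suc j * + head a)) (∈Σ?-complete {a = a} (next-multiple j (∈Σ?-sound {a = tail a} j∈))) sj∉
    where
    multiple : ℕ → ℕ
    multiple j = residue (+ j * + head a)
    multiple-0 : multiple 0 ≡ 0
    multiple-0 = residue-unique 0<p (≈-reflexive (sym (ℤ.*-zeroˡ (+ head a))))
    next-multiple : ∀ j → multiple j ∈Σ tail a → multiple (suc j) ∈Σ a
    next-multiple j j∈ = ∈Σ-shift≈ {a = a} (residue-< (+ suc j * + head a)) j∈ (begin
      + multiple (suc j)              ≈⟨ residue-≈ (+ suc j * + head a) ⟩
      + suc j * + head a              ≡⟨ suc-step j (+ head a) ⟩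
      + head a +ℤ + j * + head a      ≈⟨ +-congˡ (+ head a) (residue-≈ (+ j * + head a)) ⟨
      + head a +ℤ + multiple j        ∎)
      where open ≈-Reasoning

  card-lower : ∀ (a : Vector ℕ ℓ) → (∀ i → a i < p) → (∀ i → a i ≢ 0) → suc ℓ ≤ p → suc ℓ ≤ card a
  card-lower {zero} a _ _ _ = count-injection (∈Σ? a) p (λ _ → 0) 1 (λ _ _ → 0<p)
    (λ _ _ → ∈Σ?-complete {a = a} (0∈Σ a)) (λ i j i<1 j<1 _ → trans (ℕ.n<1⇒n≡0 i<1) (sym (ℕ.n<1⇒n≡0 j<1)))
  card-lower {suc ℓ} a a<p a≢0 ℓ+2≤p with card (tail a) ℕ.<? p
  ... | yes not-full = ℕ.≤-trans (s≤s (card-lower (tail a) (λ i → a<p (suc i)) (λ i → a≢0 (suc i)) (ℕ.<⇒≤ ℓ+2≤p)))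
                                  (card-grow a (a<p zero) (a≢0 zero) not-full)
  ... | no full      = ℕ.≤-trans ℓ+2≤p (ℕ.≤-trans (ℕ.≮⇒≥ full) (card-tail a))

  -- Σ(a) does not depend on the order of the terms; adjacent transpositions suffice here.
  swap : Vector ℕ (2 ℕ.+ ℓ) → Vector ℕ (2 ℕ.+ ℓ)
  swap a = a (suc zero) ∷ a zero ∷ tail (tail a)

  swap-index : Fin (2 ℕ.+ ℓ) → Fin (2 ℕ.+ ℓ)
  swap-index zero          = suc zero
  swap-index (suc zero)    = zero
  swap-index (suc (suc i)) = suc (suc i)

  swap-index-involutive : ∀ (i : Fin (2 ℕ.+ ℓ)) → swap-index (swap-index i) ≡ i
  swap-index-involutive zero          = refl
  swap-index-involutive (suc zero)    = refl
  swap-index-involutive (suc (suc i)) = refl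

  swap-by-index : ∀ (a : Vector ℕ (2 ℕ.+ ℓ)) i → swap a i ≡ a (swap-index i)
  swap-by-index a zero          = refl
  swap-by-index a (suc zero)    = refl
  swap-by-index a (suc (suc i)) = refl

  -- Two translations commute, so exchanging two terms preserves the subsums.
  +[p]-comm : ∀ u v s → u +[ p ] (v +[ p ] s) ≡ v +[ p ] (u +[ p ] s)
  +[p]-comm u v s = ≈⇒≡ (m%n<n _ p) (m%n<n _ p) (begin
    + (u +[ p ] (v +[ p ] s))   ≈⟨ ≈-trans (plus≈ u _) (+-congˡ (+ u) (plus≈ v s)) ⟩
    + u +ℤ (+ v +ℤ + s)         ≡⟨ exchange (+ u) (+ v) (+ s) ⟩
    + v +ℤ (+ u +ℤ + s)         ≈⟨ ≈-trans (plus≈ v _) (+-congˡ (+ v) (plus≈ u s)) ⟨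
    + (v +[ p ] (u +[ p ] s))   ∎)
    where
    open ≈-Reasoning
    exchange : ∀ u v s → u +ℤ (v +ℤ s) ≡ v +ℤ (u +ℤ s)
    exchange = solve-∀

  ∈Σ-swap : ∀ (a : Vector ℕ (2 ℕ.+ ℓ)) {y} → y ∈Σ a → y ∈Σ swap a
  ∈Σ-swap a y∈ with ∈Σ-cons⁻ {a = a} y∈
  ... | inj₁ y∈tail with ∈Σ-cons⁻ {a = tail a} y∈tail
  ...   | inj₁ y∈tail²          = ∈Σ-tail {a = swap a} (∈Σ-tail {a = tail (swap a)} y∈tail²)
  ...   | inj₂ (s , s∈ , refl)  = ∈Σ-shift {a = swap a} (∈Σ-tail {a = tail (swap a)} s∈)
  ∈Σ-swap a y∈ | inj₂ (s , s∈ , refl) with ∈Σ-cons⁻ {a = tail a} s∈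
  ... | inj₁ s∈tail²          = ∈Σ-tail {a = swap a} (∈Σ-shift {a = tail (swap a)} s∈tail²)
  ... | inj₂ (u , u∈ , refl)  = subst (_∈Σ swap a) (+[p]-comm (a (suc zero)) (a zero) u)
                                  (∈Σ-shift {a = swap a} (∈Σ-shift {a = tail (swap a)} u∈))

  card-swap : ∀ (a : Vector ℕ (2 ℕ.+ ℓ)) → card (swap a) ≡ card a
  card-swap a = ℕ.≤-antisym (card-⊆ (swap a) a (∈Σ-swap (swap a))) (card-⊆ a (swap a) (∈Σ-swap a))

  ∈Σ-cons-cong : ∀ (a b : Vector ℕ (suc ℓ)) → head a ≡ head b → (∀ {y} → y ∈Σ tail a → y ∈Σ tail b)
    → ∀ {y} → y ∈Σ a → y ∈Σ b
  ∈Σ-cons-cong a b same-head tail⊆ y∈ with ∈Σ-cons⁻ {a = a} y∈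
  ... | inj₁ y∈tail          = ∈Σ-tail {a = b} (tail⊆ y∈tail)
  ... | inj₂ (s , s∈ , refl) = subst (λ h → h +[ p ] s ∈Σ b) (sym same-head) (∈Σ-shift {a = b} (tail⊆ s∈))

  OnProgression : ℤ → ℤ → ℕ → ℕ → Set
  OnProgression x r m y = Σ ℕ λ i → i < m × + y ≈ x +ℤ + i * r

  record IsProgression (a : Vector ℕ ℓ) (x r : ℤ) (m : ℕ) : Set where
    constructor progression
    field
      on-progression : ∀ {y} → y < p → y ∈Σ a → OnProgression x r m y
      in-Σ           : ∀ {y} → y < p → OnProgression x r m y → y ∈Σ a
  open IsProgression

  card-progression : ∀ {a : Vector ℕ ℓ} {x r m} → r ≉ 0ℤ → m ≤ p → IsProgression a x r m → card a ≡ m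
  card-progression {a = a} {x} {r} {m} r≉0 m≤p prog = ℕ.≤-antisym upper lower
    where
    point : ℕ → ℕ
    point i = residue (x +ℤ + i * r)
    upper : card a ≤ m
    upper = count-cover (∈Σ? a) p point m λ y y<p y∈ →
      let i , i<m , y≈ = on-progression prog y<p (∈Σ?-sound {a = a} y∈) in i , i<m , sym (residue-unique y<p y≈)
    lower : m ≤ card a
    lower = count-injection (∈Σ? a) p point m (λ i _ → residue-< (x +ℤ + i * r))
      (λ i i<m → ∈Σ?-complete {a = a} (in-Σ prog (residue-< (x +ℤ + i * r)) (i , i<m , residue-≈ (x +ℤ + i * r))))
      (λ i j i<m j<m same → progression-injective {x} r≉0 (ℕ.<-≤-trans i<m m≤p) (ℕ.<-≤-trans j<m m≤p)
        (≈-trans (≈-sym (residue-≈ (x +ℤ + i * r))) (≈-trans (≈-reflexive (cong +_ same)) (residue-≈ (x +ℤ + j * r)))))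

  progression-[] : ∀ (a : Vector ℕ 0) r → IsProgression a 0ℤ r 1
  progression-[] a r = progression to from
    where
    0≈ : 0ℤ ≈ 0ℤ +ℤ + 0 * r
    0≈ = ≈-reflexive (sym (trans (ℤ.+-identityˡ (+ 0 * r)) (ℤ.*-zeroˡ r)))
    to : ∀ {y} → y < p → y ∈Σ a → OnProgression 0ℤ r 1 y
    to _ (here refl) = 0 , s≤s z≤n , ≈-trans (residue-≈ 0ℤ) 0≈
    from : ∀ {y} → y < p → OnProgression 0ℤ r 1 y → y ∈Σ a
    from y<p (0 , _ , y≈) = here (sym (residue-unique y<p (≈-trans y≈ (≈-sym 0≈))))
    from _ (suc _ , s≤s () , _)

  private
    up-new : ∀ x r t i → t * r +ℤ (x +ℤ i * r) ≡ x +ℤ (t +ℤ i) * r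
    up-new = solve-∀
    down-old : ∀ x r d i → x +ℤ i * r ≡ (x - d * r) +ℤ (d +ℤ i) * r
    down-old = solve-∀
    down-new : ∀ x r d i → - (d * r) +ℤ (x +ℤ i * r) ≡ (x - d * r) +ℤ i * r
    down-new = solve-∀

  shift-point : ∀ x r t i → + t * r +ℤ (x +ℤ + i * r) ≡ x +ℤ + (t ℕ.+ i) * r
  shift-point x r t i = trans (up-new x r (+ t) (+ i)) (cong (λ n → x +ℤ n * r) (sym (ℤ.pos-+ t i)))

  restart-point : ∀ x r d i → x +ℤ + i * r ≡ (x - + d * r) +ℤ + (d ℕ.+ i) * r
  restart-point x r d i = trans (down-old x r (+ d) (+ i)) (cong (λ n → (x - + d * r) +ℤ n * r) (sym (ℤ.pos-+ d i)))

  index-below : ∀ {k d m} → d ≤ k → k < d ℕ.+ m → k ∸ d < m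
  index-below {k} {d} {m} d≤k k<d+m = subst (k ∸ d <_) (ℕ.m+n∸m≡n d m) (ℕ.∸-monoˡ-< k<d+m d≤k)

  old-point : ∀ {a : Vector ℕ (suc ℓ)} {x r m i y} → IsProgression (tail a) x r m → i < m → y < p
    → + y ≈ x +ℤ + i * r → y ∈Σ a
  old-point {a = a} prog i<m y<p y≈ = ∈Σ-tail {a = a} (in-Σ prog y<p (_ , i<m , y≈))

  shifted-point : ∀ {a : Vector ℕ (suc ℓ)} {x r m i y} → IsProgression (tail a) x r m → i < m → y < p
    → + y ≈ + head a +ℤ (x +ℤ + i * r) → y ∈Σ a
  shifted-point {a = a} {x} {r} {i = i} prog i<m y<p y≈ = ∈Σ-shift≈ {a = a} y<p
    (in-Σ prog (residue-< (x +ℤ + i * r)) (i , i<m , residue-≈ (x +ℤ + i * r)))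
    (≈-trans y≈ (+-congˡ (+ head a) (≈-sym (residue-≈ (x +ℤ + i * r)))))

  extend-up : ∀ {a : Vector ℕ (suc ℓ)} {x r m d} → d ≤ m → IsProgression (tail a) x r m
    → + head a ≈ + d * r → IsProgression a x r (d ℕ.+ m)
  extend-up {a = a} {x} {r} {m} {d} d≤m prog a₀≈ = progression to from
    where
    to : ∀ {y} → y < p → y ∈Σ a → OnProgression x r (d ℕ.+ m) y
    to {y} y<p y∈ with ∈Σ-cons⁻ {a = a} y∈
    ... | inj₁ y∈tail =
      let i , i<m , y≈ = on-progression prog y<p y∈tail in i , ℕ.<-≤-trans i<m (ℕ.m≤n+m m d) , y≈
    ... | inj₂ (s , s∈ , refl) =
      let i , i<m , s≈ = on-progression prog (∈Σ-< (tail a) s∈) s∈ in d ℕ.+ i , ℕ.+-monoʳ-< d i<m , (begin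
        + (head a +[ p ] s)          ≈⟨ plus≈ (head a) s ⟩
        + head a +ℤ + s              ≈⟨ +-cong a₀≈ s≈ ⟩
        + d * r +ℤ (x +ℤ + i * r)    ≡⟨ shift-point x r d i ⟩
        x +ℤ + (d ℕ.+ i) * r         ∎)
      where open ≈-Reasoning
    from : ∀ {y} → y < p → OnProgression x r (d ℕ.+ m) y → y ∈Σ a
    from {y} y<p (k , k<d+m , y≈) with k ℕ.<? m
    ... | yes k<m = old-point {a = a} {x} {r} prog k<m y<p y≈
    ... | no k≮m  = shifted-point {a = a} {x} {r} prog (index-below d≤k k<d+m) y<p (begin
        + y                               ≈⟨ y≈ ⟩
        x +ℤ + k * r                      ≡⟨ cong (λ k → x +ℤ + k * r) (ℕ.m+[n∸m]≡n d≤k) ⟨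
        x +ℤ + (d ℕ.+ (k ∸ d)) * r        ≡⟨ shift-point x r d (k ∸ d) ⟨
        + d * r +ℤ (x +ℤ + (k ∸ d) * r)   ≈⟨ +-congʳ (x +ℤ + (k ∸ d) * r) (≈-sym a₀≈) ⟩
        + head a +ℤ (x +ℤ + (k ∸ d) * r)  ∎)
      where
      open ≈-Reasoning
      d≤k : d ≤ k
      d≤k = ℕ.≤-trans d≤m (ℕ.≮⇒≥ k≮m)

  extend-down : ∀ {a : Vector ℕ (suc ℓ)} {x r m d} → d ≤ m → IsProgression (tail a) x r m
    → + head a ≈ - (+ d * r) → IsProgression a (x - + d * r) r (d ℕ.+ m)
  extend-down {a = a} {x} {r} {m} {d} d≤m prog a₀≈ = progression to from
    where
    x′ = x - + d * r
    to : ∀ {y} → y < p → y ∈Σ a → OnProgression x′ r (d ℕ.+ m) y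
    to {y} y<p y∈ with ∈Σ-cons⁻ {a = a} y∈
    ... | inj₁ y∈tail =
      let i , i<m , y≈ = on-progression prog y<p y∈tail in
      d ℕ.+ i , ℕ.+-monoʳ-< d i<m , ≈-trans y≈ (≈-reflexive (restart-point x r d i))
    ... | inj₂ (s , s∈ , refl) =
      let i , i<m , s≈ = on-progression prog (∈Σ-< (tail a) s∈) s∈ in i , ℕ.<-≤-trans i<m (ℕ.m≤n+m m d) , (begin
        + (head a +[ p ] s)              ≈⟨ plus≈ (head a) s ⟩
        + head a +ℤ + s                  ≈⟨ +-cong a₀≈ s≈ ⟩
        - (+ d * r) +ℤ (x +ℤ + i * r)    ≡⟨ down-new x r (+ d) (+ i) ⟩
        x′ +ℤ + i * r                    ∎)
      where open ≈-Reasoning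
    from : ∀ {y} → y < p → OnProgression x′ r (d ℕ.+ m) y → y ∈Σ a
    from {y} y<p (k , k<d+m , y≈) with d ℕ.≤? k
    ... | yes d≤k = old-point {a = a} {x} {r} prog (index-below d≤k k<d+m) y<p (begin
        + y                            ≈⟨ y≈ ⟩
        x′ +ℤ + k * r                  ≡⟨ cong (λ k → x′ +ℤ + k * r) (ℕ.m+[n∸m]≡n d≤k) ⟨
        x′ +ℤ + (d ℕ.+ (k ∸ d)) * r    ≡⟨ restart-point x r d (k ∸ d) ⟨
        x +ℤ + (k ∸ d) * r             ∎)
      where open ≈-Reasoning
    ... | no d≰k = shifted-point {a = a} {x} {r} prog (ℕ.<-≤-trans (ℕ.≰⇒> d≰k) d≤m) y<p (begin
        + y                              ≈⟨ y≈ ⟩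
        x′ +ℤ + k * r                    ≡⟨ down-new x r (+ d) (+ k) ⟨
        - (+ d * r) +ℤ (x +ℤ + k * r)    ≈⟨ +-congʳ (x +ℤ + k * r) (≈-sym a₀≈) ⟩
        + head a +ℤ (x +ℤ + k * r)       ∎)
      where open ≈-Reasoning

  extend : ∀ {a : Vector ℕ (suc ℓ)} {x r m d} → d ≤ m → IsProgression (tail a) x r m
    → + head a ≈± + d * r → Σ ℤ λ x′ → IsProgression a x′ r (d ℕ.+ m)
  extend d≤m prog (inj₁ a₀≈) = _ , extend-up d≤m prog a₀≈
  extend d≤m prog (inj₂ a₀≈) = _ , extend-down d≤m prog a₀≈

  -- Overlap, in general form: after prepending t·r to a progression x, …, x + (m-1)·r,
  -- the points x + (s+j)·r for j < k lie beyond it (m ≤ s) and are translates by t·r of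
  -- old points (as (s-t) + j < m), so the sequence gains k new subsums.
  card-beyond : ∀ {a : Vector ℕ (suc ℓ)} {x r m t k} s → r ≉ 0ℤ → IsProgression (tail a) x r m → + head a ≈ + t * r
    → m ≤ s → t ≤ s → s ℕ.+ k ≤ p → (∀ j → j < k → (s ∸ t) ℕ.+ j < m) → m ℕ.+ k ≤ card a
  card-beyond {a = a} {x} {r} {m} {t} {k} s r≉0 prog a₀≈ m≤s t≤s s+k≤p translate =
    subst (λ c → c ℕ.+ k ≤ card a) (card-progression {a = tail a} {x} r≉0 m≤p prog)
      (count-extra {∈Σ? a} {∈Σ? (tail a)} p new k (∈Σ?-tail a)
        (λ j _ → residue-< (point j)) new∈ new∉ new-injective)
    where
    m≤p : m ≤ p
    m≤p = ℕ.≤-trans m≤s (ℕ.≤-trans (ℕ.m≤m+n s k) s+k≤p)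
    point : ℕ → ℤ
    point j = x +ℤ + (s ℕ.+ j) * r
    new : ℕ → ℕ
    new j = residue (point j)
    s+j<p : ∀ {j} → j < k → s ℕ.+ j < p
    s+j<p j<k = ℕ.<-≤-trans (ℕ.+-monoʳ-< s j<k) s+k≤p
    new∈ : ∀ j → j < k → ∈Σ? a (new j) ≡ true
    new∈ j j<k = ∈Σ?-complete {a = a} (shifted-point {a = a} {x} {r} prog (translate j j<k) (residue-< (point j)) (begin
      + new j                                  ≈⟨ residue-≈ (point j) ⟩
      x +ℤ + (s ℕ.+ j) * r                     ≡⟨ cong (λ i → x +ℤ + i * r) t+[s∸t+j]≡s+j ⟨
      x +ℤ + (t ℕ.+ (s ∸ t ℕ.+ j)) * r         ≡⟨ shift-point x r t (s ∸ t ℕ.+ j) ⟨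
      + t * r +ℤ (x +ℤ + (s ∸ t ℕ.+ j) * r)    ≈⟨ +-congʳ (x +ℤ + (s ∸ t ℕ.+ j) * r) (≈-sym a₀≈) ⟩
      + head a +ℤ (x +ℤ + (s ∸ t ℕ.+ j) * r)   ∎))
      where
      open ≈-Reasoning
      t+[s∸t+j]≡s+j : t ℕ.+ (s ∸ t ℕ.+ j) ≡ s ℕ.+ j
      t+[s∸t+j]≡s+j = trans (sym (ℕ.+-assoc t (s ∸ t) j)) (cong (ℕ._+ j) (ℕ.m+[n∸m]≡n t≤s))
    new∉ : ∀ j → j < k → ∈Σ? (tail a) (new j) ≡ false
    new∉ j j<k = ∈Σ?-false {a = tail a} λ new∈tail →
      let i , i<m , new≈ = on-progression prog (residue-< (point j)) new∈tail
          m≤s+j = ℕ.≤-trans m≤s (ℕ.m≤m+n s j)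
          s+j≡i = progression-injective {x} r≉0 (s+j<p j<k) (ℕ.<-≤-trans i<m (ℕ.≤-trans m≤s+j (ℕ.<⇒≤ (s+j<p j<k))))
                    (≈-trans (≈-sym (residue-≈ (point j))) new≈)
      in ℕ.<⇒≱ i<m (ℕ.≤-trans m≤s+j (ℕ.≤-reflexive s+j≡i))
    new-injective : ∀ i j → i < k → j < k → new i ≡ new j → i ≡ j
    new-injective i j i<k j<k same = ℕ.+-cancelˡ-≡ s i j (progression-injective {x} r≉0 (s+j<p i<k) (s+j<p j<k)
      (≈-trans (≈-sym (residue-≈ (point i))) (≈-trans (≈-reflexive (cong +_ same)) (residue-≈ (point j)))))

  -- Overlap: prepending t·r with k ≤ t ≤ p - k to a progression of length m ≥ k adds at
  -- least k subsums (take s = m if t ≤ m, and s = t otherwise).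
  card-overlap : ∀ {a : Vector ℕ (suc ℓ)} {x r m t k} → r ≉ 0ℤ → IsProgression (tail a) x r m → + head a ≈ + t * r
    → k ≤ m → k ≤ t → m ℕ.+ k ≤ p → t ℕ.+ k ≤ p → m ℕ.+ k ≤ card a
  card-overlap {a = a} {m = m} {t} {k} r≉0 prog a₀≈ k≤m k≤t m+k≤p t+k≤p with ℕ.≤-total t m
  ... | inj₁ t≤m = card-beyond {a = a} m r≉0 prog a₀≈ ℕ.≤-refl t≤m m+k≤p λ j j<k →
    subst (m ∸ t ℕ.+ j <_) (ℕ.m∸n+n≡m t≤m) (ℕ.+-monoʳ-< (m ∸ t) (ℕ.<-≤-trans j<k k≤t))
  ... | inj₂ m≤t = card-beyond {a = a} t r≉0 prog a₀≈ m≤t ℕ.≤-refl t+k≤p λ j j<k →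
    subst (_< m) (cong (ℕ._+ j) (sym (ℕ.n∸n≡0 t))) (ℕ.<-≤-trans j<k k≤m)

  -- Prepending a nonzero a₀ to a sequence whose subsums form a progression of length m with
  -- step r: writing a₀ ≈ t·r, either t or p - t lies strictly between 0 and k (so a₀ ≈ ±j·r
  -- with 0 < j < k), or overlap applies and the sequence gains at least k subsums.
  prepend : ∀ {a : Vector ℕ (suc ℓ)} {x r m} k → r ≉ 0ℤ → IsProgression (tail a) x r m → head a < p → head a ≢ 0
    → k ≤ m → m ℕ.+ k ≤ p → (Σ ℕ λ j → 0 < j × j < k × + head a ≈± + j * r) ⊎ m ℕ.+ k ≤ card a
  prepend {a = a} {x} {r} {m} k r≉0 prog a₀<p a₀≢0 k≤m m+k≤p = classify (multiple-onto r≉0 a₀<p)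
    where
    classify : (Σ ℕ λ t → t < p × + head a ≈ + t * r)
      → (Σ ℕ λ j → 0 < j × j < k × + head a ≈± + j * r) ⊎ m ℕ.+ k ≤ card a
    classify (t , t<p , a₀≈) with t ℕ.<? k | t ℕ.+ k ℕ.≤? p
    ... | yes t<k | _ = inj₁ (t , ℕ.n≢0⇒n>0 t≢0 , t<k , inj₁ a₀≈)
      where
      t≢0 : t ≢ 0
      t≢0 refl = nonzero a₀<p a₀≢0 (≈-trans a₀≈ (≈-reflexive (ℤ.*-zeroˡ r)))
    ... | no t≮k | yes t+k≤p = inj₂ (card-overlap {a = a} r≉0 prog a₀≈ k≤m (ℕ.≮⇒≥ t≮k) m+k≤p t+k≤p)
    ... | no _   | no t+k≰p  = inj₁ (p ∸ t , ℕ.m<n⇒0<n∸m t<p , p∸t<k ,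
                                      inj₂ (≈-trans a₀≈ (complement≈ {t} {p ∸ t} r (ℕ.m+[n∸m]≡n (ℕ.<⇒≤ t<p)))))
      where
      p∸t<k : p ∸ t < k
      p∸t<k = subst (p ∸ t <_) (ℕ.m+n∸m≡n t k) (ℕ.∸-monoˡ-< (ℕ.≰⇒> t+k≰p) (ℕ.<⇒≤ t<p))

  PlusMinus : ℤ → Vector ℕ ℓ → Set
  PlusMinus r a = r ≉ 0ℤ × (∀ i → + a i ≈± r)

  TypeI : ℤ → Vector ℕ ℓ → Set
  TypeI {ℓ} r a = r ≉ 0ℤ × Σ (Fin ℓ) λ i₀ → + a i₀ ≈± + 2 * r × (∀ i → i ≢ i₀ → + a i ≈± r)

  plus-minus-progression : ∀ (a : Vector ℕ ℓ) {r} → (∀ i → + a i ≈± r) → Σ ℤ λ x → IsProgression a x r (suc ℓ)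
  plus-minus-progression {zero}  a {r} _ = 0ℤ , progression-[] a r
  plus-minus-progression {suc ℓ} a {r} a≈±r =
    let x , prog = plus-minus-progression (tail a) (λ i → a≈±r (suc i))
    in extend {a = a} (s≤s z≤n) prog (≈±-cong (one* r) (a≈±r zero))

  card-plus-minus : ∀ {r} (a : Vector ℕ ℓ) → PlusMinus r a → suc ℓ ≤ p → card a ≡ suc ℓ
  card-plus-minus a (r≉0 , a≈±r) ℓ<p = card-progression r≉0 ℓ<p (proj₂ (plus-minus-progression a a≈±r))

  card-tail-range : ∀ (a : Vector ℕ (suc ℓ)) → (∀ i → a i < p) → (∀ i → a i ≢ 0) → suc ℓ ≤ p → card a < p
    → suc ℓ ≤ card (tail a) × card (tail a) < card a
  card-tail-range a a<p a≢0 ℓ<p card<p =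
    card-lower (tail a) (λ i → a<p (suc i)) (λ i → a≢0 (suc i)) ℓ<p ,
    card-grow a (a<p zero) (a≢0 zero) (ℕ.≤-<-trans (card-tail a) card<p)

  -- `prepend` when |Σ(a)| = m + k - 1 < p is known: the overlap alternative is impossible.
  prepend-tight : ∀ {a : Vector ℕ (suc ℓ)} {x r m} k → r ≉ 0ℤ → IsProgression (tail a) x r m → head a < p → head a ≢ 0
    → k ≤ m → suc (card a) ≡ k ℕ.+ m → card a < p → Σ ℕ λ j → 0 < j × j < k × + head a ≈± + j * r
  prepend-tight {a = a} {m = m} k r≉0 prog a₀<p a₀≢0 k≤m card≡ card<p =
    [ (λ offset → offset) , (λ big → ⊥-elim (ℕ.<-irrefl refl (subst (_≤ card a) m+k≡ big))) ]′
      (prepend {a = a} k r≉0 prog a₀<p a₀≢0 k≤m (subst (_≤ p) (sym m+k≡) card<p))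
    where
    m+k≡ : m ℕ.+ k ≡ suc (card a)
    m+k≡ = trans (ℕ.+-comm m k) (sym card≡)

  offset-one : ∀ {x r} → (Σ ℕ λ j → 0 < j × j < 2 × x ≈± + j * r) → x ≈± r
  offset-one {r = r} (1 , _ , _ , x≈±r) = ≈±-cong (≈-sym (one* r)) x≈±r
  offset-one (suc (suc _) , _ , s≤s (s≤s ()) , _)

  offset-one-or-two : ∀ {x r} → (Σ ℕ λ j → 0 < j × j < 3 × x ≈± + j * r) → x ≈± r ⊎ x ≈± + 2 * r
  offset-one-or-two {r = r} (1 , _ , _ , x≈±r)  = inj₁ (≈±-cong (≈-sym (one* r)) x≈±r)
  offset-one-or-two         (2 , _ , _ , x≈±2r) = inj₂ x≈±2r
  offset-one-or-two (suc (suc (suc _)) , _ , s≤s (s≤s (s≤s ())) , _)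

  -- |Σ(a)| = ℓ + 1 < p forces all terms of a to be ±r: by induction Σ(tail a) is a
  -- progression of length ℓ with step r, and a₀ must then be ±r.
  minimal-card : ∀ (a : Vector ℕ (suc ℓ)) → (∀ i → a i < p) → (∀ i → a i ≢ 0)
    → card a ≡ suc (suc ℓ) → suc (suc ℓ) < p → Σ ℤ λ r → PlusMinus r a
  minimal-card {zero} a a<p a≢0 _ _ = + a zero , nonzero (a<p zero) (a≢0 zero) , λ { zero → inj₁ ≈-refl }
  minimal-card {suc ℓ} a a<p a≢0 card≡ ℓ<p =
    let r , r≉0 , tail≈±r = minimal-card (tail a) (λ i → a<p (suc i)) (λ i → a≢0 (suc i)) tail-card
                               (ℕ.<-trans (ℕ.n<1+n _) ℓ<p)
        head≈±r = offset-one (prepend-tight {a = a} 2 r≉0 (proj₂ (plus-minus-progression (tail a) tail≈±r))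
                    (a<p zero) (a≢0 zero) (s≤s (s≤s z≤n)) (cong suc card≡) card<p)
    in r , r≉0 , λ { zero → head≈±r ; (suc i) → tail≈±r i }
    where
    card<p = subst (_< p) (sym card≡) ℓ<p
    range = card-tail-range a a<p a≢0 (ℕ.<⇒≤ (ℕ.<-trans (ℕ.n<1+n _) ℓ<p)) card<p
    tail-card : card (tail a) ≡ suc (suc ℓ)
    tail-card = ℕ.≤-antisym (s≤s⁻¹ (subst (card (tail a) <_) card≡ (proj₂ range))) (proj₁ range)

  -- If the tail of a (at least two terms) is ±r and |Σ(a)| = ℓ + 2 < p, then a₀ is ±2r:
  -- a₀ ≈ ±r would leave only ℓ + 1 subsums, and any other a₀ creates at least ℓ + 3.
  plus-minus-tail⇒typeI : ∀ (a : Vector ℕ (3 ℕ.+ ℓ)) → (∀ i → a i < p) → (∀ i → a i ≢ 0)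
    → ∀ {r} → PlusMinus r (tail a) → card a ≡ 5 ℕ.+ ℓ → 5 ℕ.+ ℓ < p → TypeI r a
  plus-minus-tail⇒typeI {ℓ} a a<p a≢0 {r} (r≉0 , tail≈±r) card≡ ℓ<p =
    r≉0 , zero , [ not-±r , (λ head≈±2r → head≈±2r) ]′ (offset-one-or-two offset) ,
    λ { zero zero≢zero → ⊥-elim (zero≢zero refl) ; (suc i) _ → tail≈±r i }
    where
    offset = prepend-tight {a = a} 3 r≉0 (proj₂ (plus-minus-progression (tail a) tail≈±r)) (a<p zero) (a≢0 zero)
               (s≤s (s≤s (s≤s z≤n))) (cong suc card≡) (subst (_< p) (sym card≡) ℓ<p)
    not-±r : + a zero ≈± r → + a zero ≈± + 2 * r
    not-±r head≈±r = ⊥-elim (ℕ.<-irrefl (trans (sym (card-plus-minus a (r≉0 , λ { zero → head≈±r ; (suc i) → tail≈±r i })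
      (ℕ.<⇒≤ (ℕ.<-trans (ℕ.n<1+n _) ℓ<p)))) card≡) (ℕ.n<1+n _))

  progression-transport : ∀ {ℓ ℓ′} {a : Vector ℕ ℓ} {b : Vector ℕ ℓ′} {x r m} → (∀ {y} → y ∈Σ a → y ∈Σ b)
    → (∀ {y} → y ∈Σ b → y ∈Σ a) → IsProgression a x r m → IsProgression b x r m
  progression-transport a⊆b b⊆a prog =
    progression (λ y<p → on-progression prog y<p ∘′ b⊆a) (λ y<p → a⊆b ∘′ in-Σ prog y<p)

  -- Subsums of a sequence of type (i) with at least two terms: the progression
  -- x, x + r, …, x + (ℓ+1)·r. Put the ±2r term first, behind at least one ±r term.
  double-first-progression : ∀ (a : Vector ℕ (2 ℕ.+ ℓ)) {r} → + head a ≈± + 2 * r → (∀ i → + tail a i ≈± r)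
    → Σ ℤ λ x → IsProgression a x r (4 ℕ.+ ℓ)
  double-first-progression a a₀≈±2r tail≈±r =
    extend {a = a} (s≤s (s≤s z≤n)) (proj₂ (plus-minus-progression (tail a) tail≈±r)) a₀≈±2r

  -- In general induct until the ±2r term comes first; for two terms exchange them.
  typeI-progression : ∀ (a : Vector ℕ (2 ℕ.+ ℓ)) {r} → TypeI r a → Σ ℤ λ x → IsProgression a x r (4 ℕ.+ ℓ)
  typeI-progression a (_ , zero , a₀≈±2r , rest) = double-first-progression a a₀≈±2r (λ i → rest (suc i) λ ())
  typeI-progression {zero} a (_ , suc zero , a₁≈±2r , rest) =
    let x , prog = double-first-progression (swap a) a₁≈±2r (λ { zero → rest zero λ () })
    in x , progression-transport (∈Σ-swap (swap a)) (∈Σ-swap a) prog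
  typeI-progression {suc ℓ} a {r} (r≉0 , suc i₀ , a≈±2r , rest) =
    let x , prog = typeI-progression (tail a) (r≉0 , i₀ , a≈±2r , λ i i≢i₀ → rest (suc i) (i≢i₀ ∘′ suc-injective))
    in extend {a = a} (s≤s z≤n) prog (≈±-cong (one* r) (rest zero λ ()))

  -- If tail a is of type (i) for r and |Σ(a)| = ℓ + 2 < p, then so is a: Σ(tail a) is a
  -- progression of length ℓ + 1 with step r, and a₀ ≈ ±r is the only way not to add
  -- two or more subsums.
  typeI-tail⇒typeI : ∀ (a : Vector ℕ (3 ℕ.+ ℓ)) → (∀ i → a i < p) → (∀ i → a i ≢ 0)
    → ∀ {r} → TypeI r (tail a) → card a ≡ 5 ℕ.+ ℓ → 5 ℕ.+ ℓ < p → TypeI r a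
  typeI-tail⇒typeI {ℓ} a a<p a≢0 {r} (r≉0 , i₀ , tail₀≈±2r , rest) card≡ ℓ<p =
    r≉0 , suc i₀ , tail₀≈±2r , λ { zero _ → head≈±r ; (suc i) i≢ → rest i (i≢ ∘′ cong suc) }
    where
    head≈±r : + a zero ≈± r
    head≈±r = offset-one (prepend-tight {a = a} 2 r≉0 (proj₂ (typeI-progression (tail a) (r≉0 , i₀ , tail₀≈±2r , rest)))
                (a<p zero) (a≢0 zero) (s≤s (s≤s z≤n)) (cong suc card≡) (subst (_< p) (sym card≡) ℓ<p))

  typeI-rearrange : ∀ {r} (a b : Vector ℕ ℓ) (π : Fin ℓ → Fin ℓ) → (∀ i → π (π i) ≡ i) → (∀ i → b i ≡ a (π i))
    → TypeI r b → TypeI r a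
  typeI-rearrange {r = r} a b π π-involutive b≡aπ (r≉0 , i₀ , b₀≈±2r , rest) =
    r≉0 , π i₀ , subst (λ v → + v ≈± + 2 * r) (b≡aπ i₀) b₀≈±2r ,
    λ i i≢πi₀ → subst (λ v → + v ≈± r) (trans (b≡aπ (π i)) (cong a (π-involutive i)))
                  (rest (π i) (λ πi≡i₀ → i≢πi₀ (trans (sym (π-involutive i)) (cong π πi≡i₀))))

  FourSums : ℤ → ℤ → ℤ → Set
  FourSums u v w = w ≈ 0ℤ ⊎ w ≈ v ⊎ w ≈ u ⊎ w ≈ u +ℤ v

  FourSums-cong : ∀ {u v w w′} → w ≈ w′ → FourSums u v w → FourSums u v w′
  FourSums-cong w≈w′ (inj₁ e)               = inj₁ (≈-trans (≈-sym w≈w′) e)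
  FourSums-cong w≈w′ (inj₂ (inj₁ e))        = inj₂ (inj₁ (≈-trans (≈-sym w≈w′) e))
  FourSums-cong w≈w′ (inj₂ (inj₂ (inj₁ e))) = inj₂ (inj₂ (inj₁ (≈-trans (≈-sym w≈w′) e)))
  FourSums-cong w≈w′ (inj₂ (inj₂ (inj₂ e))) = inj₂ (inj₂ (inj₂ (≈-trans (≈-sym w≈w′) e)))

  FourSums-swap : ∀ {u v w} → FourSums u v w → FourSums v u w
  FourSums-swap         (inj₁ e)               = inj₁ e
  FourSums-swap         (inj₂ (inj₁ e))        = inj₂ (inj₂ (inj₁ e))
  FourSums-swap         (inj₂ (inj₂ (inj₁ e))) = inj₂ (inj₁ e)
  FourSums-swap {u} {v} (inj₂ (inj₂ (inj₂ e))) = inj₂ (inj₂ (inj₂ (≈-trans e (≈-reflexive (ℤ.+-comm u v)))))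

  -- x + 0 (mod p), the form in which single terms appear in the list of subsums.
  plus-zero≈ : ∀ x → + (x +[ p ] (0 % p)) ≈ + x
  plus-zero≈ x = ≈-trans (plus≈ x (0 % p)) (≈-trans (+-congˡ (+ x) (residue-≈ 0ℤ)) (≈-reflexive (ℤ.+-identityʳ (+ x))))

  ∈Σ-pair⁻ : ∀ (b : Vector ℕ 2) {y} → y ∈Σ b → FourSums (+ b zero) (+ b (suc zero)) (+ y)
  ∈Σ-pair⁻ b (here refl)                         = inj₁ (residue-≈ 0ℤ)
  ∈Σ-pair⁻ b (there (here refl))                 = inj₂ (inj₁ (plus-zero≈ (b (suc zero))))
  ∈Σ-pair⁻ b (there (there (here refl)))         = inj₂ (inj₂ (inj₁ (plus-zero≈ (b zero))))
  ∈Σ-pair⁻ b (there (there (there (here refl)))) =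
    inj₂ (inj₂ (inj₂ (≈-trans (plus≈ (b zero) _) (+-congˡ (+ b zero) (plus-zero≈ (b (suc zero)))))))

  private
    minus-neg : ∀ x v → (x +ℤ v) - 0ℤ ≡ x - (- v)
    minus-neg = solve-∀
    minus-self : ∀ x v → (x +ℤ v) - v ≡ x - 0ℤ
    minus-self = solve-∀
    minus-both : ∀ x u v → (x +ℤ v) - (u +ℤ v) ≡ x - u
    minus-both = solve-∀
    twice-v : ∀ x u v → (x - (u +ℤ v)) +ℤ (u - (x +ℤ v)) ≡ 0ℤ - + 2 * v
    twice-v = solve-∀
    twice-x : ∀ x u v → ((x +ℤ v) - u) +ℤ ((x +ℤ u) - v) ≡ + 2 * x - 0ℤ
    twice-x = solve-∀
    self-shift : ∀ x y → (x +ℤ y) - x ≡ y - 0ℤ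
    self-shift = solve-∀

  module _ {a₀ u v : ℤ} (a₀≉0 : a₀ ≉ 0ℤ) (a₀≉±u : ¬ a₀ ≈± u) (a₀≉±v : ¬ a₀ ≈± v) where

    unshifted-in-pair : FourSums u v a₀ → a₀ ≈ u +ℤ v
    unshifted-in-pair (inj₁ a₀≈0)                 = ⊥-elim (a₀≉0 a₀≈0)
    unshifted-in-pair (inj₂ (inj₁ a₀≈v))          = ⊥-elim (a₀≉±v (inj₁ a₀≈v))
    unshifted-in-pair (inj₂ (inj₂ (inj₁ a₀≈u)))   = ⊥-elim (a₀≉±u (inj₁ a₀≈u))
    unshifted-in-pair (inj₂ (inj₂ (inj₂ a₀≈u+v))) = a₀≈u+v

    shifted-in-pair : FourSums u v (a₀ +ℤ v) → a₀ +ℤ v ≈ u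
    shifted-in-pair (inj₁ e)               = ⊥-elim (a₀≉±v (inj₂ (≈-via e (minus-neg a₀ v))))
    shifted-in-pair (inj₂ (inj₁ e))        = ⊥-elim (a₀≉0 (≈-via e (minus-self a₀ v)))
    shifted-in-pair (inj₂ (inj₂ (inj₁ e))) = e
    shifted-in-pair (inj₂ (inj₂ (inj₂ e))) = ⊥-elim (a₀≉±u (inj₁ (≈-via e (minus-both a₀ u v))))

  -- Two of these coincidences together give an element of order two …
  unshifted-shifted : ∀ {a₀ u v} → a₀ ≈ u +ℤ v → a₀ +ℤ v ≈ u → + 2 * v ≈ 0ℤ
  unshifted-shifted {a₀} {u} {v} e₀ e₁ = ≈-sym (≈-via₂ e₀ (≈-sym e₁) (twice-v a₀ u v))

  shifted-shifted : ∀ {a₀ u v} → a₀ +ℤ v ≈ u → a₀ +ℤ u ≈ v → + 2 * a₀ ≈ 0ℤ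
  shifted-shifted {a₀} {u} {v} e₁ e₂ = ≈-via₂ e₁ e₂ (twice-x a₀ u v)

  -- … which does not exist for p > 2.
  double≈0 : 2 < p → ∀ {x} → + 2 * x ≈ 0ℤ → x ≈ 0ℤ
  double≈0 2<p {x} 2x≈0 = [ (λ 2≈0 → ⊥-elim (nonzero 2<p (λ ()) 2≈0)) , (λ x≈0 → x≈0) ]′ (zero-product (+ 2) x 2x≈0)

  -- Three nonzero residues a₀, a₁, a₂, no two of which agree up to sign, have at least six
  -- subsums: Σ(a₁, a₂) has four elements, and at most one of a₀, a₀ + a₂, a₀ + a₁ lies in it.
  module _ (a : Vector ℕ 3) (a<p : ∀ i → a i < p) (a≢0 : ∀ i → a i ≢ 0) (3<p : 3 < p)
           (a₀≉±a₁ : ¬ + a zero ≈± + a (suc zero)) (a₀≉±a₂ : ¬ + a zero ≈± + a (suc (suc zero)))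
           (a₁≉±a₂ : ¬ + a (suc zero) ≈± + a (suc (suc zero))) where

    private
      A₀ A₁ A₂ : ℤ
      A₀ = + a zero
      A₁ = + a (suc zero)
      A₂ = + a (suc (suc zero))

      a≉0 : ∀ i → + a i ≉ 0ℤ
      a≉0 i = nonzero (a<p i) (a≢0 i)

      -- |Σ(a₁, a₂)| = 4: three subsums would make a₁, a₂ both ±r for one r.
      tail-card : 4 ≤ card (tail a)
      tail-card = ℕ.≤∧≢⇒< (card-lower (tail a) (λ i → a<p (suc i)) (λ i → a≢0 (suc i)) (ℕ.<⇒≤ 3<p)) λ 3≡card →
        let r , _ , tail≈±r = minimal-card (tail a) (λ i → a<p (suc i)) (λ i → a≢0 (suc i)) (sym 3≡card) 3<p
        in a₁≉±a₂ (≈±-trans (tail≈±r zero) (≈±-sym (tail≈±r (suc zero))))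

      c₀ c₁ c₂ : ℕ
      c₀ = a zero
      c₁ = residue (A₀ +ℤ A₂)
      c₂ = residue (A₀ +ℤ A₁)

      c₀∈ : ∈Σ? a c₀ ≡ true
      c₀∈ = ∈Σ?-complete {a = a} (term∈Σ a zero (a<p zero))
      c₁∈ : ∈Σ? a c₁ ≡ true
      c₁∈ = ∈Σ?-complete {a = a} (∈Σ-shift≈ {a = a} (residue-< (A₀ +ℤ A₂)) (term∈Σ (tail a) (suc zero) (a<p _)) (residue-≈ (A₀ +ℤ A₂)))
      c₂∈ : ∈Σ? a c₂ ≡ true
      c₂∈ = ∈Σ?-complete {a = a} (∈Σ-shift≈ {a = a} (residue-< (A₀ +ℤ A₁)) (term∈Σ (tail a) zero (a<p _)) (residue-≈ (A₀ +ℤ A₁)))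

      in-tail : ∀ {c} → ∈Σ? (tail a) c ≡ true → FourSums A₁ A₂ (+ c)
      in-tail h = ∈Σ-pair⁻ (tail a) (∈Σ?-sound {a = tail a} h)

      E₀ : ∈Σ? (tail a) c₀ ≡ true → A₀ ≈ A₁ +ℤ A₂
      E₀ h = unshifted-in-pair (a≉0 zero) a₀≉±a₁ a₀≉±a₂ (in-tail h)
      E₁ : ∈Σ? (tail a) c₁ ≡ true → A₀ +ℤ A₂ ≈ A₁
      E₁ h = shifted-in-pair (a≉0 zero) a₀≉±a₁ a₀≉±a₂ (FourSums-cong (residue-≈ (A₀ +ℤ A₂)) (in-tail h))
      E₂ : ∈Σ? (tail a) c₂ ≡ true → A₀ +ℤ A₁ ≈ A₂
      E₂ h = shifted-in-pair (a≉0 zero) a₀≉±a₂ a₀≉±a₁ (FourSums-swap (FourSums-cong (residue-≈ (A₀ +ℤ A₁)) (in-tail h)))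

      c₀≢c₁ : c₀ ≢ c₁
      c₀≢c₁ eq = a≉0 (suc (suc zero)) (≈-via (≈-trans (≈-sym (residue-≈ (A₀ +ℤ A₂))) (≈-reflexive (cong +_ (sym eq)))) (self-shift A₀ A₂))
      c₀≢c₂ : c₀ ≢ c₂
      c₀≢c₂ eq = a≉0 (suc zero) (≈-via (≈-trans (≈-sym (residue-≈ (A₀ +ℤ A₁))) (≈-reflexive (cong +_ (sym eq)))) (self-shift A₀ A₁))
      c₁≢c₂ : c₁ ≢ c₂
      c₁≢c₂ eq = a₁≉±a₂ (inj₁ (≈-sym (+-cancelˡ {A₀}
        (≈-trans (≈-sym (residue-≈ (A₀ +ℤ A₂))) (≈-trans (≈-reflexive (cong +_ eq)) (residue-≈ (A₀ +ℤ A₁)))))))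

      two-new : ∀ {u v} → u ≢ v → ∈Σ? a u ≡ true → ∈Σ? a v ≡ true → ∈Σ? (tail a) u ≡ false → ∈Σ? (tail a) v ≡ false
        → 6 ≤ card a
      two-new {u} {v} u≢v u∈ v∈ u∉ v∉ = ℕ.≤-trans (ℕ.+-monoˡ-≤ 2 tail-card)
        (count-grow₂ {∈Σ? a} {∈Σ? (tail a)} u v p (∈Σ?-tail a)
          u≢v (∈Σ-< a (∈Σ?-sound {a = a} u∈)) (∈Σ-< a (∈Σ?-sound {a = a} v∈)) u∈ v∈ u∉ v∉)

      2<p : 2 < p
      2<p = ℕ.<-trans (ℕ.n<1+n 2) 3<p

      -- Two coincidences are contradictory, otherwise two candidates are new.
      by-membership : ∀ b₀ b₁ b₂ → ∈Σ? (tail a) c₀ ≡ b₀ → ∈Σ? (tail a) c₁ ≡ b₁ → ∈Σ? (tail a) c₂ ≡ b₂ → 6 ≤ card a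
      by-membership true  true  _     h₀ h₁ _  =
        ⊥-elim (a≉0 (suc (suc zero)) (double≈0 2<p (unshifted-shifted {A₀} {A₁} {A₂} (E₀ h₀) (E₁ h₁))))
      by-membership true  false true  h₀ _  h₂ =
        ⊥-elim (a≉0 (suc zero) (double≈0 2<p (unshifted-shifted {A₀} {A₂} {A₁} (≈-trans (E₀ h₀) (≈-reflexive (ℤ.+-comm A₁ A₂))) (E₂ h₂))))
      by-membership false true  true  _  h₁ h₂ = ⊥-elim (a≉0 zero (double≈0 2<p (shifted-shifted {A₀} {A₁} {A₂} (E₁ h₁) (E₂ h₂))))
      by-membership true  false false _  h₁ h₂ = two-new c₁≢c₂ c₁∈ c₂∈ h₁ h₂
      by-membership false true  false h₀ _  h₂ = two-new c₀≢c₂ c₀∈ c₂∈ h₀ h₂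
      by-membership false false _     h₀ h₁ _  = two-new c₀≢c₁ c₀∈ c₁∈ h₀ h₁

    triple-spread : 6 ≤ card a
    triple-spread = by-membership _ _ _ refl refl refl

  rearranged-all : ∀ {ℓ} {P : ℕ → Set} (a b : Vector ℕ ℓ) (π : Fin ℓ → Fin ℓ) → (∀ i → b i ≡ a (π i))
    → (∀ i → P (a i)) → ∀ i → P (b i)
  rearranged-all {P = P} a b π b≡aπ all i = subst P (sym (b≡aπ i)) (all (π i))

  -- Three terms with a₀ ≈ ±a₂: after exchanging a₀ and a₁ the tail (a₀, a₂) is ±a₀.
  first-last-related : ∀ (a : Vector ℕ 3) → (∀ i → a i < p) → (∀ i → a i ≢ 0)
    → + a zero ≈± + a (suc (suc zero)) → card a ≡ 5 → 5 < p → Σ ℤ λ r → TypeI r a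
  first-last-related a a<p a≢0 a₀≈±a₂ card≡ 5<p = + a zero ,
    typeI-rearrange a (swap a) swap-index swap-index-involutive (swap-by-index a)
      (plus-minus-tail⇒typeI (swap a) (rearranged-all {P = _< p} a (swap a) swap-index (swap-by-index a) a<p)
        (rearranged-all {P = _≢ 0} a (swap a) swap-index (swap-by-index a) a≢0)
        (nonzero (a<p zero) (a≢0 zero) , λ { zero → inj₁ ≈-refl ; (suc zero) → ≈±-sym a₀≈±a₂ })
        (trans (card-swap a) card≡) 5<p)

  last-swap : Vector ℕ 3 → Vector ℕ 3
  last-swap a = a zero ∷ swap (tail a)

  last-swap-index : Fin 3 → Fin 3
  last-swap-index zero    = zero
  last-swap-index (suc i) = suc (swap-index i)

  last-swap-by-index : ∀ (a : Vector ℕ 3) i → last-swap a i ≡ a (last-swap-index i)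
  last-swap-by-index a zero    = refl
  last-swap-by-index a (suc i) = swap-by-index (tail a) i

  card-last-swap : ∀ (a : Vector ℕ 3) → card (last-swap a) ≡ card a
  card-last-swap a = ℕ.≤-antisym
    (card-⊆ (last-swap a) a (∈Σ-cons-cong (last-swap a) a refl (∈Σ-swap (swap (tail a)))))
    (card-⊆ a (last-swap a) (∈Σ-cons-cong a (last-swap a) refl (∈Σ-swap (tail a))))

  -- The lemma for three terms whose last two are not ±-related: a₀ is ±-related to a₂
  -- or to a₁ (then reorder and apply plus-minus-tail⇒typeI), or triple-spread applies.
  triple : ∀ (a : Vector ℕ 3) → (∀ i → a i < p) → (∀ i → a i ≢ 0) → ¬ + a (suc zero) ≈± + a (suc (suc zero))
    → card a ≡ 5 → 5 < p → Σ ℤ λ r → TypeI r a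
  triple a a<p a≢0 a₁≉±a₂ card≡ 5<p = by-relations (+ a zero ≈±? + a (suc (suc zero))) (+ a zero ≈±? + a (suc zero))
    where
    by-relations : Dec (+ a zero ≈± + a (suc (suc zero))) → Dec (+ a zero ≈± + a (suc zero)) → Σ ℤ λ r → TypeI r a
    by-relations (yes a₀≈±a₂) _ = first-last-related a a<p a≢0 a₀≈±a₂ card≡ 5<p
    by-relations (no _) (yes a₀≈±a₁) =
      let r , typeI = first-last-related (last-swap a)
                        (rearranged-all {P = _< p} a (last-swap a) last-swap-index (last-swap-by-index a) a<p)
                        (rearranged-all {P = _≢ 0} a (last-swap a) last-swap-index (last-swap-by-index a) a≢0)
                        a₀≈±a₁ (trans (card-last-swap a) card≡) 5<p
      in r , typeI-rearrange a (last-swap a) last-swap-index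
               (λ { zero → refl ; (suc i) → cong suc (swap-index-involutive i) }) (last-swap-by-index a) typeI
    by-relations (no a₀≉±a₂) (no a₀≉±a₁) = ⊥-elim (ℕ.<⇒≱ (subst (_< 6) (sym card≡) ℕ.≤-refl)
      (triple-spread a a<p a≢0 (ℕ.<-trans (ℕ.n<1+n 3) (ℕ.<-trans (ℕ.n<1+n 4) 5<p)) a₀≉±a₁ a₀≉±a₂ a₁≉±a₂))

  tail-card-cases : ∀ (a : Vector ℕ (3 ℕ.+ ℓ)) → (∀ i → a i < p) → (∀ i → a i ≢ 0) → card a ≡ 5 ℕ.+ ℓ → 5 ℕ.+ ℓ < p
    → card (tail a) ≡ 3 ℕ.+ ℓ ⊎ card (tail a) ≡ 4 ℕ.+ ℓ
  tail-card-cases {ℓ} a a<p a≢0 card≡ ℓ<p with card (tail a) ℕ.≟ 3 ℕ.+ ℓ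
  ... | yes small = inj₁ small
  ... | no  large = inj₂ (ℕ.≤-antisym (s≤s⁻¹ (subst (card (tail a) <_) card≡ (proj₂ range))) (ℕ.≤∧≢⇒< (proj₁ range) (large ∘′ sym)))
    where
    range = card-tail-range a a<p a≢0 (ℕ.<⇒≤ (ℕ.<-trans (ℕ.n<1+n _) (ℕ.<-trans (ℕ.n<1+n _) ℓ<p))) (subst (_< p) (sym card≡) ℓ<p)

  unrelated-tail : ∀ (a : Vector ℕ 3) → (∀ i → a i < p) → (∀ i → a i ≢ 0) → 3 < p → card (tail a) ≡ 4
    → ¬ + a (suc zero) ≈± + a (suc (suc zero))
  unrelated-tail a a<p a≢0 3<p tail-card a₁≈±a₂ =
    ℕ.<-irrefl (trans (sym (card-plus-minus (tail a) plus-minus (ℕ.<⇒≤ 3<p))) tail-card) (ℕ.n<1+n 3)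
    where
    plus-minus : PlusMinus (+ a (suc zero)) (tail a)
    plus-minus = nonzero (a<p (suc zero)) (a≢0 (suc zero)) , λ { zero → inj₁ ≈-refl ; (suc zero) → ≈±-sym a₁≈±a₂ }

  -- The lemma for ℓ + 3 terms, by induction on ℓ. If the tail has ℓ + 3 subsums it is ±r
  -- and a₀ ≈ ±2r; if it has ℓ + 4, it is of type (i) by induction (by `triple` for ℓ = 0)
  -- and a₀ ≈ ±r.
  typeI-of-card : ∀ (a : Vector ℕ (3 ℕ.+ ℓ)) → (∀ i → a i < p) → (∀ i → a i ≢ 0)
    → card a ≡ 5 ℕ.+ ℓ → 5 ℕ.+ ℓ < p → Σ ℤ λ r → TypeI r a
  typeI-of-card a a<p a≢0 card≡ ℓ<p with tail-card-cases a a<p a≢0 card≡ ℓ<p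
  ... | inj₁ tail-card =
    let r , plus-minus = minimal-card (tail a) (λ i → a<p (suc i)) (λ i → a≢0 (suc i)) tail-card (ℕ.<-trans (ℕ.n<1+n _) (ℕ.<-trans (ℕ.n<1+n _) ℓ<p))
    in r , plus-minus-tail⇒typeI a a<p a≢0 plus-minus card≡ ℓ<p
  typeI-of-card {zero} a a<p a≢0 card≡ ℓ<p | inj₂ tail-card =
    triple a a<p a≢0 (unrelated-tail a a<p a≢0 (ℕ.<-trans (ℕ.n<1+n 3) (ℕ.<-trans (ℕ.n<1+n 4) ℓ<p)) tail-card) card≡ ℓ<p
  typeI-of-card {suc ℓ} a a<p a≢0 card≡ ℓ<p | inj₂ tail-card =
    let r , typeI = typeI-of-card (tail a) (λ i → a<p (suc i)) (λ i → a≢0 (suc i)) tail-card (ℕ.<-trans (ℕ.n<1+n _) ℓ<p)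
    in r , typeI-tail⇒typeI a a<p a≢0 typeI card≡ ℓ<p

  AlternativeI : ∀ ℓ → Vector ℕ ℓ → Set
  AlternativeI ℓ a = Σ ℕ (λ r → (r < p) × (r ≢ 0) × Σ (Fin ℓ) (λ i₀ → ((a i₀ ≡ two*[ p ] r) ⊎ (a i₀ ≡ neg[ p ] (two*[ p ] r)))
                       × (∀ i → i ≢ i₀ → (a i ≡ r) ⊎ (a i ≡ neg[ p ] r))))

  canonical-± : ∀ {x y z} → y < p → z < p → + z ≈ x → + y ≈± x → y ≡ z ⊎ y ≡ neg[ p ] z
  canonical-± y<p z<p z≈x (inj₁ y≈x)  = inj₁ (≈⇒≡ y<p z<p (≈-trans y≈x (≈-sym z≈x)))
  canonical-± {z = z} y<p z<p z≈x (inj₂ y≈-x) =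
    inj₂ (≈⇒≡ y<p (m%n<n _ p) (≈-trans y≈-x (≈-sym (≈-trans (neg≈ z) (neg-cong z≈x)))))

  typeI⇒alternativeI : ∀ (a : Vector ℕ ℓ) → (∀ i → a i < p) → ∀ {r} → TypeI r a → AlternativeI ℓ a
  typeI⇒alternativeI a a<p {r} (r≉0 , i₀ , a₀≈±2r , rest) =
    residue r , residue-< r , (λ ρ≡0 → r≉0 (≈-trans (≈-sym (residue-≈ r)) (≈-reflexive (cong +_ ρ≡0)))) ,
    i₀ , canonical-± (a<p i₀) (m%n<n _ p) (≈-trans (two≈ (residue r)) (*-cong (≈-refl {+ 2}) (residue-≈ r))) a₀≈±2r ,
    λ i i≢i₀ → canonical-± (a<p i) (residue-< r) (residue-≈ r) (rest i i≢i₀)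

lemma2p5 : (p : ℕ) → .{{_ : NonZero p}} → Prime p → (ℓ : ℕ) → 2 ≤ ℓ → (a : Fin ℓ → ℕ) → (∀ i → a i < p) → (∀ i → a i ≢ 0) → cardΣ p ℓ a ≡ ℓ + 2 → ℓ + 2 < p
    → (Σ ℕ (λ r → (r < p) × (r ≢ 0) × Σ (Fin ℓ) (λ i₀ → ((a i₀ ≡ two*[ p ] r) ⊎ (a i₀ ≡ neg[ p ] (two*[ p ] r))) × (∀ i → i ≢ i₀ → (a i ≡ r) ⊎ (a i ≡ neg[ p ] r)))))
      ⊎ (ℓ ≡ 2)
lemma2p5 p _ 0 () a a<p a≢0 card≡ ℓ+2<p
lemma2p5 p _ 1 (s≤s ()) a a<p a≢0 card≡ ℓ+2<p
lemma2p5 p _ 2 _ a a<p a≢0 card≡ ℓ+2<p = inj₂ refl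
lemma2p5 p p-prime (suc (suc (suc ℓ))) _ a a<p a≢0 card≡ ℓ+2<p =
  inj₁ (typeI⇒alternativeI a a<p (proj₂ (typeI-of-card a a<p a≢0 card≡5+ℓ 5+ℓ<p)))
  where
  open Modulo p p-prime
  card≡5+ℓ : card a ≡ 5 + ℓ
  card≡5+ℓ = trans (sym (cardΣ≡card _ a)) (trans card≡ (+-comm (3 + ℓ) 2))
  5+ℓ<p : 5 + ℓ < p
  5+ℓ<p = subst (_< p) (+-comm (3 + ℓ) 2) ℓ+2<p
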